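{- For every integer $n\geq 6$, \[\left[\binom{n}{2}-6,\ \binom{n}{3}-(n-3)\left\lceil\frac{n-2}{2}\right\rceil+f(n-2)\right]\subseteq S(n,2),\] where $f(t)=0$ for $t\leq 2$, $f(t)=1$ for $t\in\{3,4\}$, $f(t)=3$ for $t\in\{5,6\}$, $f(t)=4$ for $t\in\{7,8\}$, $f(t)=7$ for $t\in\{9,10\}$, and $f(t)=t-1$ for $t\geq 11$.
   Context: $S(n,2)$ denotes the set of sizes $|\mathcal A|$ of maximal antichains $\mathcal A$ in the Boolean lattice $B_n$ (all subsets of $[n]$ ordered by inclusion) with $\mathcal A\subseteq\binom{[n]}{2}\cup\binom{[n]}{3}$, where $\binom{[n]}{j}$ is the family of $j$-element subsets of $[n]$; maximal means no subset of $[n]$ can be added while keeping the antichain property. Intervals $[a,b]$ denote sets of integers. -}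

module Defs where

open import Data.Nat using (ℕ; zero; suc; _+_; _*_; _∸_; _≤_; ⌈_/2⌉)
open import Data.Nat.Combinatorics using (_C_)
open import Data.Fin.Subset using (Subset; _⊆_; ∣_∣)
open import Data.List using (List; length)
open import Data.List.Membership.Propositional using (_∈_; _∉_)
open import Data.List.Relation.Unary.All using (All)
open import Data.List.Relation.Unary.Unique.Propositional using (Unique)
open import Data.Product using (Σ; ∃; _×_; _,_)
open import Data.Sum using (_⊎_)
open import Relation.Binary.PropositionalEquality using (_≡_)

IsAntichain : {n : ℕ} → List (Subset n) → Set
IsAntichain 𝒜 = ∀ {A B} → A ∈ 𝒜 → B ∈ 𝒜 → A ⊆ B → A ≡ B

IsMaximal : {n : ℕ} → List (Subset n) → Set
IsMaximal {n} 𝒜 = ∀ (X : Subset n) → X ∉ 𝒜 →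
  ∃ λ A → A ∈ 𝒜 × (X ⊆ A ⊎ A ⊆ X)

InLevels23 : {n : ℕ} → List (Subset n) → Set
InLevels23 𝒜 = All (λ A → ∣ A ∣ ≡ 2 ⊎ ∣ A ∣ ≡ 3) 𝒜

InS2 : ℕ → ℕ → Set
InS2 n m = ∃ λ (𝒜 : List (Subset n)) →
  Unique 𝒜 × IsAntichain 𝒜 × IsMaximal 𝒜 × InLevels23 𝒜 × length 𝒜 ≡ m

f : ℕ → ℕ
f 0 = 0
f 1 = 0
f 2 = 0
f 3 = 1
f 4 = 1
f 5 = 3
f 6 = 3
f 7 = 4
f 8 = 4
f 9 = 7
f 10 = 7
f (suc t) = t   -- t+1 ≥ 11 here, so f (t+1) = (t+1) - 1

-- The edges of a graph on [n] together with its independent triples form an antichain in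
-- levels 2 and 3. It is maximal when every non-edge lies in an independent triple, which
-- holds if some vertex is isolated and no other vertex is adjacent to all remaining ones.
-- For a forest with e edges and s paths of length two the antichain has C(n,3) − e(n−3) + s
-- members. Joining a new vertex to all others adds n members, so by induction on n it
-- remains to reach the sizes from U(n−1) + n up to U(n) on n vertices. They come from
-- forests made of a caterpillar, a matching and isolated vertices: for n ≥ 17 suitable e
-- and s are found by elementary arithmetic, for n ≤ 16 the parameters are listed explicitly.

module Submission where

open import Defs
open import Data.Bool using (Bool; true; false; _∧_; _∨_; not; if_then_else_)
open import Data.Bool.Properties using (∧-conicalˡ; ∧-conicalʳ; ∧-zeroʳ; ∧-identityʳ) renaming (_≟_ to _≟ᵇ_)
open import Data.Empty using (⊥-elim)
open import Data.Fin using (Fin; zero; suc)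
open import Data.Fin.Subset using (Subset; ∣_∣; ⊥; ⊤; _⊆_; ⁅_⁆; _∈_; _∉_)
open import Data.Fin.Subset.Properties
  using (anySubset?; _⊆?_; drop-∷-⊆; out⊆; in⊆in; s⊆s; ⊆-trans; ⊆-antisym; ⊆-min; ⊆⊤; ⊆-refl; _∈?_;
         p⊆q⇒∣p∣≤∣q∣; p⊂q⇒∣p∣<∣q∣; ∣⊥∣≡0; ∣⊤∣≡n; ∣⁅x⁆∣≡1; x∈⁅y⁆⇒x≡y; ∉⊥)
open import Data.List using (List; []; _∷_; [_]; length; map; _++_; replicate; upTo)
open import Data.List.Properties using (length-++; length-map)
open import Data.List.Membership.Propositional using () renaming (_∈_ to _∈ˡ_)
open import Data.List.Membership.Propositional.Properties
  using (∈-map⁺; ∈-map⁻; ∈-++⁺ˡ; ∈-++⁺ʳ; ∈-++⁻; ∈-upTo⁺)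
open import Data.List.Relation.Unary.Any using (Any; here; there)
import Data.List.Relation.Unary.Any.Properties as Any
import Data.List.Relation.Unary.All as All
open import Data.List.Relation.Unary.AllPairs using ([]; _∷_)
open import Data.List.Relation.Unary.Unique.Propositional using (Unique)
open import Data.List.Relation.Unary.Unique.Propositional.Properties using (++⁺; map⁺)
open import Data.Nat
  using (ℕ; zero; suc; _+_; _*_; _∸_; _≤_; _≰_; _<_; z≤n; s≤s; _≡ᵇ_; _≤?_; _<?_; _≟_; ⌈_/2⌉)
open import Data.Nat.Properties
open import Algebra.Properties.CommutativeSemigroup +-commutativeSemigroup
  using (interchange; x∙yz≈xz∙y; xy∙z≈xz∙y; x∙yz≈y∙xz)
open import Data.Nat.Combinatorics using (_C_; nCk+nC[k+1]≡[n+1]C[k+1]; nC1≡n)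
open import Data.Nat.Tactic.RingSolver using (solve-∀)
open import Data.Product using (Σ; ∃; _×_; _,_; proj₁; proj₂)
open import Data.Unit using (tt) renaming (⊤ to Unit)
open import Data.Sum as Sum using (_⊎_; inj₁; inj₂)
open import Data.Vec using ([]; _∷_; here; there)
open import Data.Vec.Properties using (∷-injectiveʳ)
open import Function using (_∘_; id)
open import Relation.Binary.PropositionalEquality hiding ([_])
open import Relation.Nullary using (¬_; Dec; yes; no)
open import Relation.Nullary.Decidable
  using (from-yes; from-no; decidable-stable; ¬?; _×-dec_; _⊎-dec_; _→-dec_)

variable
  n h : ℕ

subsetsWith : (Subset n → Bool) → List (Subset n)
subsetsWith {zero}  P = if P [] then [ [] ] else []
subsetsWith {suc n} P =
  map (false ∷_) (subsetsWith (P ∘ (false ∷_))) ++ map (true ∷_) (subsetsWith (P ∘ (true ∷_)))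

countSubsets : (Subset n → Bool) → ℕ
countSubsets {zero}  P = if P [] then 1 else 0
countSubsets {suc n} P = countSubsets (P ∘ (false ∷_)) + countSubsets (P ∘ (true ∷_))

length-subsetsWith : ∀ (P : Subset n → Bool) → length (subsetsWith P) ≡ countSubsets P
length-subsetsWith {zero} P with P []
... | true  = refl
... | false = refl
length-subsetsWith {suc n} P = begin
  length (map (false ∷_) A ++ map (true ∷_) B)         ≡⟨ length-++ (map (false ∷_) A) ⟩
  length (map (false ∷_) A) + length (map (true ∷_) B) ≡⟨ cong₂ _+_ (length-map _ A) (length-map _ B) ⟩
  length A + length B
    ≡⟨ cong₂ _+_ (length-subsetsWith (P ∘ (false ∷_))) (length-subsetsWith (P ∘ (true ∷_))) ⟩
  countSubsets P                                       ∎
  where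
  open ≡-Reasoning
  A = subsetsWith (P ∘ (false ∷_))
  B = subsetsWith (P ∘ (true ∷_))

∈-subsetsWith⁻ : ∀ (P : Subset n → Bool) {S} → S ∈ˡ subsetsWith P → P S ≡ true
∈-subsetsWith⁻ {zero} P {[]} S∈ with P []
... | true = refl
∈-subsetsWith⁻ {zero} P {[]} () | false
∈-subsetsWith⁻ {suc n} P S∈ with ∈-++⁻ (map (false ∷_) (subsetsWith (P ∘ (false ∷_)))) S∈
... | inj₁ S∈ˡ with ∈-map⁻ (false ∷_) S∈ˡ
...   | _ , T∈ , refl = ∈-subsetsWith⁻ (P ∘ (false ∷_)) T∈
∈-subsetsWith⁻ {suc n} P S∈ | inj₂ S∈ʳ with ∈-map⁻ (true ∷_) S∈ʳ
...   | _ , T∈ , refl = ∈-subsetsWith⁻ (P ∘ (true ∷_)) T∈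

∈-subsetsWith⁺ : ∀ (P : Subset n → Bool) {S} → P S ≡ true → S ∈ˡ subsetsWith P
∈-subsetsWith⁺ {zero}  P {[]} PS rewrite PS = here refl
∈-subsetsWith⁺ {suc n} P {false ∷ S} PS =
  ∈-++⁺ˡ (∈-map⁺ (false ∷_) (∈-subsetsWith⁺ (P ∘ (false ∷_)) PS))
∈-subsetsWith⁺ {suc n} P {true ∷ S} PS =
  ∈-++⁺ʳ _ (∈-map⁺ (true ∷_) (∈-subsetsWith⁺ (P ∘ (true ∷_)) PS))

subsetsWith-unique : ∀ (P : Subset n → Bool) → Unique (subsetsWith P)
subsetsWith-unique {zero} P with P []
... | true  = All.[] ∷ []
... | false = []
subsetsWith-unique {suc n} P =
  ++⁺ (map⁺ ∷-injectiveʳ (subsetsWith-unique _)) (map⁺ ∷-injectiveʳ (subsetsWith-unique _)) headsDiffer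
  where
  A = subsetsWith (P ∘ (false ∷_))
  B = subsetsWith (P ∘ (true ∷_))
  headsDiffer : ∀ {S} → ¬ (S ∈ˡ map (false ∷_) A × S ∈ˡ map (true ∷_) B)
  headsDiffer (S∈ˡ , S∈ʳ) with ∈-map⁻ (false ∷_) S∈ˡ | ∈-map⁻ (true ∷_) S∈ʳ
  ... | _ , _ , refl | _ , _ , ()

⊆∧∣≡∣⇒≡ : ∀ {A B : Subset n} → A ⊆ B → ∣ A ∣ ≡ ∣ B ∣ → A ≡ B
⊆∧∣≡∣⇒≡ {A = A} {B} A⊆B ∣A∣≡∣B∣ = ⊆-antisym A⊆B B⊆A
  where
  B⊆A : B ⊆ A
  B⊆A {x} x∈B with x ∈? A
  ... | yes x∈A = x∈A
  ... | no  x∉A = ⊥-elim (<-irrefl ∣A∣≡∣B∣ (p⊂q⇒∣p∣<∣q∣ (A⊆B , x , x∈B , x∉A)))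

∣p∣≡0⇒p≡⊥ : ∀ {S : Subset n} → ∣ S ∣ ≡ 0 → S ≡ ⊥
∣p∣≡0⇒p≡⊥ {S = []}        _ = refl
∣p∣≡0⇒p≡⊥ {S = false ∷ S} e = cong (false ∷_) (∣p∣≡0⇒p≡⊥ e)

x∈p⇒⁅x⁆⊆p : ∀ {j : Fin n} {S} → j ∈ S → ⁅ j ⁆ ⊆ S
x∈p⇒⁅x⁆⊆p {j = j} j∈S x∈⁅j⁆ rewrite x∈⁅y⁆⇒x≡y j x∈⁅j⁆ = j∈S

subset-of-size : ∀ k (X : Subset n) → k ≤ ∣ X ∣ → ∃ λ T → T ⊆ X × ∣ T ∣ ≡ k
subset-of-size k (false ∷ X) k≤ with subset-of-size k X k≤
... | T , T⊆X , ∣T∣ = false ∷ T , s⊆s T⊆X , ∣T∣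
subset-of-size {suc n} zero (true ∷ X) _ = ⊥ , ⊆-min _ , ∣⊥∣≡0 (suc n)
subset-of-size (suc k) (true ∷ X) (s≤s k≤) with subset-of-size k X k≤
... | T , T⊆X , ∣T∣ = true ∷ T , in⊆in T⊆X , cong suc ∣T∣
subset-of-size zero [] _ = [] , (λ ()) , refl

superset-of-size : ∀ k (X : Subset n) → ∣ X ∣ ≤ k → k ≤ n → ∃ λ P → X ⊆ P × ∣ P ∣ ≡ k
superset-of-size zero [] _ _ = [] , (λ ()) , refl
superset-of-size {suc n} k (false ∷ X) ∣X∣≤k k≤1+n with k ≤? n
... | yes k≤n with superset-of-size k X ∣X∣≤k k≤n
...   | P , X⊆P , ∣P∣ = false ∷ P , s⊆s X⊆P , ∣P∣
superset-of-size {suc n} k (false ∷ X) ∣X∣≤k k≤1+n | no k≰n =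
  ⊤ , ⊆⊤ , trans (∣⊤∣≡n (suc n)) (≤-antisym (≰⇒> k≰n) k≤1+n)
superset-of-size (suc k) (true ∷ X) (s≤s ∣X∣≤k) (s≤s k≤n) with superset-of-size k X ∣X∣≤k k≤n
... | P , X⊆P , ∣P∣ = true ∷ P , in⊆in X⊆P , cong suc ∣P∣

-- Graphs and their antichains

-- Graphs on [n] are built vertex by vertex: R ◃ G adds a new vertex 0 adjacent to R.
infixr 5 _◃_
data Graph : ℕ → Set where
  ∅   : Graph 0
  _◃_ : Subset n → Graph n → Graph (suc n)

disjoint : Subset n → Subset n → Bool
disjoint []          []          = true
disjoint (true ∷ R)  (true ∷ S)  = false
disjoint (true ∷ R)  (false ∷ S) = disjoint R S
disjoint (false ∷ R) (_ ∷ S)     = disjoint R S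

independent : Graph n → Subset n → Bool
independent ∅       []          = true
independent (R ◃ G) (false ∷ S) = independent G S
independent (R ◃ G) (true ∷ S)  = disjoint R S ∧ independent G S

edgeOrTriple : ℕ → Bool → Bool
edgeOrTriple 2 isIndependent = not isIndependent
edgeOrTriple 3 isIndependent = isIndependent
edgeOrTriple _ _             = false

inAntichain : Graph n → Subset n → Bool
inAntichain G S = edgeOrTriple ∣ S ∣ (independent G S)

PairsInTriples : Graph n → Set
PairsInTriples {n} G = ∀ (S : Subset n) → ∣ S ∣ ≡ 2 → independent G S ≡ true →
  ∃ λ T → S ⊆ T × ∣ T ∣ ≡ 3 × independent G T ≡ true

disjoint-⊥ʳ : ∀ (R : Subset n) → disjoint R ⊥ ≡ true
disjoint-⊥ʳ []          = refl
disjoint-⊥ʳ (true ∷ R)  = disjoint-⊥ʳ R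
disjoint-⊥ʳ (false ∷ R) = disjoint-⊥ʳ R

disjoint-⊥ˡ : ∀ (S : Subset n) → disjoint ⊥ S ≡ true
disjoint-⊥ˡ []      = refl
disjoint-⊥ˡ (_ ∷ S) = disjoint-⊥ˡ S

disjoint-antimonoʳ : ∀ (R : Subset n) {A B} → A ⊆ B → disjoint R B ≡ true → disjoint R A ≡ true
disjoint-antimonoʳ []          {[]}        {[]}        _   _ = refl
disjoint-antimonoʳ (true ∷ R)  {false ∷ A} {false ∷ B} A⊆B d = disjoint-antimonoʳ R (drop-∷-⊆ A⊆B) d
disjoint-antimonoʳ (false ∷ R) {_ ∷ A}     {_ ∷ B}     A⊆B d = disjoint-antimonoʳ R (drop-∷-⊆ A⊆B) d
disjoint-antimonoʳ (true ∷ R)  {true ∷ A}  {false ∷ B} A⊆B d with A⊆B here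
... | ()
disjoint-antimonoʳ (true ∷ R)  {false ∷ A} {true ∷ B}  A⊆B ()
disjoint-antimonoʳ (true ∷ R)  {true ∷ A}  {true ∷ B}  A⊆B ()

disjoint-false⇒common : ∀ (R S : Subset n) → disjoint R S ≡ false → ∃ λ j → j ∈ R × j ∈ S
disjoint-false⇒common [] [] ()
disjoint-false⇒common (true ∷ R) (true ∷ S) _ = zero , here , here
disjoint-false⇒common (true ∷ R) (false ∷ S) d with disjoint-false⇒common R S d
... | j , j∈R , j∈S = suc j , there j∈R , there j∈S
disjoint-false⇒common (false ∷ R) (_ ∷ S) d with disjoint-false⇒common R S d
... | j , j∈R , j∈S = suc j , there j∈R , there j∈S

disjoint-⁅⁆ : ∀ (R : Subset n) {j} → j ∈ R → disjoint R ⁅ j ⁆ ≡ false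
disjoint-⁅⁆ (true ∷ R)  here       = refl
disjoint-⁅⁆ (true ∷ R)  (there j∈R) = disjoint-⁅⁆ R j∈R
disjoint-⁅⁆ (false ∷ R) (there j∈R) = disjoint-⁅⁆ R j∈R

disjoint-∉ : ∀ (R : Subset n) {j} → j ∉ R → disjoint R ⁅ j ⁆ ≡ true
disjoint-∉ (false ∷ R) {zero}  _   = disjoint-⊥ʳ R
disjoint-∉ (true ∷ R)  {zero}  j∉R = ⊥-elim (j∉R here)
disjoint-∉ (true ∷ R)  {suc j} j∉R = disjoint-∉ R (j∉R ∘ there)
disjoint-∉ (false ∷ R) {suc j} j∉R = disjoint-∉ R (j∉R ∘ there)

disjoint-⊤ : ∀ (S : Subset n) → 1 ≤ ∣ S ∣ → disjoint ⊤ S ≡ false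
disjoint-⊤ (true ∷ S)  _     = refl
disjoint-⊤ (false ∷ S) 1≤∣S∣ = disjoint-⊤ S 1≤∣S∣

independent-antimono : ∀ (G : Graph n) {A B} → A ⊆ B → independent G B ≡ true → independent G A ≡ true
independent-antimono ∅       {[]}        {[]}        _   _ = refl
independent-antimono (R ◃ G) {false ∷ A} {false ∷ B} A⊆B i = independent-antimono G (drop-∷-⊆ A⊆B) i
independent-antimono (R ◃ G) {false ∷ A} {true ∷ B}  A⊆B i =
  independent-antimono G (drop-∷-⊆ A⊆B) (∧-conicalʳ _ _ i)
independent-antimono (R ◃ G) {true ∷ A}  {false ∷ B} A⊆B i with A⊆B here
... | ()
independent-antimono (R ◃ G) {true ∷ A}  {true ∷ B}  A⊆B i =
  cong₂ _∧_ (disjoint-antimonoʳ R (drop-∷-⊆ A⊆B) (∧-conicalˡ _ _ i))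
            (independent-antimono G (drop-∷-⊆ A⊆B) (∧-conicalʳ _ _ i))

independent-⊥ : ∀ (G : Graph n) → independent G ⊥ ≡ true
independent-⊥ ∅       = refl
independent-⊥ (R ◃ G) = independent-⊥ G

independent-≤1 : ∀ (G : Graph n) S → ∣ S ∣ ≤ 1 → independent G S ≡ true
independent-≤1 ∅       []          _ = refl
independent-≤1 (R ◃ G) (false ∷ S) ∣S∣≤1 = independent-≤1 G S ∣S∣≤1
independent-≤1 (R ◃ G) (true ∷ S)  (s≤s ∣S∣≤0) with ∣p∣≡0⇒p≡⊥ {S = S} (n≤0⇒n≡0 ∣S∣≤0)
... | refl = cong₂ _∧_ (disjoint-⊥ʳ R) (independent-⊥ G)

dependent⇒edge : ∀ (G : Graph n) S → independent G S ≡ false →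
  ∃ λ E → E ⊆ S × ∣ E ∣ ≡ 2 × independent G E ≡ false
dependent⇒edge ∅ [] ()
dependent⇒edge (R ◃ G) (false ∷ S) dep with dependent⇒edge G S dep
... | E , E⊆S , ∣E∣ , depE = false ∷ E , s⊆s E⊆S , ∣E∣ , depE
dependent⇒edge (R ◃ G) (true ∷ S) dep with disjoint R S in d
... | true with dependent⇒edge G S dep
...   | E , E⊆S , ∣E∣ , depE = false ∷ E , out⊆ E⊆S , ∣E∣ , depE
dependent⇒edge (R ◃ G) (true ∷ S) dep | false with disjoint-false⇒common R S d
... | j , j∈R , j∈S =
  true ∷ ⁅ j ⁆ , in⊆in (x∈p⇒⁅x⁆⊆p j∈S) , cong suc (∣⁅x⁆∣≡1 j) ,
  cong (_∧ independent G ⁅ j ⁆) (disjoint-⁅⁆ R j∈R)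

edgeOrTriple⁻ : ∀ k b → edgeOrTriple k b ≡ true → (k ≡ 2 × b ≡ false) ⊎ (k ≡ 3 × b ≡ true)
edgeOrTriple⁻ 2 false _ = inj₁ (refl , refl)
edgeOrTriple⁻ 3 true  _ = inj₂ (refl , refl)
edgeOrTriple⁻ 0 _ ()
edgeOrTriple⁻ 1 _ ()
edgeOrTriple⁻ 2 true ()
edgeOrTriple⁻ 3 false ()
edgeOrTriple⁻ (suc (suc (suc (suc k)))) _ ()

antichain : Graph n → List (Subset n)
antichain G = subsetsWith (inAntichain G)

size : Graph n → ℕ
size G = countSubsets (inAntichain G)

∈-antichain⁻ : ∀ (G : Graph n) {S} → S ∈ˡ antichain G →
  (∣ S ∣ ≡ 2 × independent G S ≡ false) ⊎ (∣ S ∣ ≡ 3 × independent G S ≡ true)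
∈-antichain⁻ G S∈ = edgeOrTriple⁻ _ _ (∈-subsetsWith⁻ (inAntichain G) S∈)

edge∈antichain : ∀ (G : Graph n) {S} → ∣ S ∣ ≡ 2 → independent G S ≡ false → S ∈ˡ antichain G
edge∈antichain G ∣S∣ dep = ∈-subsetsWith⁺ (inAntichain G) (cong₂ edgeOrTriple ∣S∣ dep)

triple∈antichain : ∀ (G : Graph n) {S} → ∣ S ∣ ≡ 3 → independent G S ≡ true → S ∈ˡ antichain G
triple∈antichain G ∣S∣ ind = ∈-subsetsWith⁺ (inAntichain G) (cong₂ edgeOrTriple ∣S∣ ind)

antichain-isAntichain : ∀ (G : Graph n) → IsAntichain (antichain G)
antichain-isAntichain G A∈ B∈ A⊆B with ∈-antichain⁻ G A∈ | ∈-antichain⁻ G B∈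
... | inj₁ (∣A∣ , _) | inj₁ (∣B∣ , _) = ⊆∧∣≡∣⇒≡ A⊆B (trans ∣A∣ (sym ∣B∣))
... | inj₂ (∣A∣ , _) | inj₂ (∣B∣ , _) = ⊆∧∣≡∣⇒≡ A⊆B (trans ∣A∣ (sym ∣B∣))
... | inj₁ (_ , depA) | inj₂ (_ , indB) with trans (sym depA) (independent-antimono G A⊆B indB)
...   | ()
antichain-isAntichain G A∈ B∈ A⊆B | inj₂ (∣A∣ , _) | inj₁ (∣B∣ , _)
  with subst₂ _≤_ ∣A∣ ∣B∣ (p⊆q⇒∣p∣≤∣q∣ A⊆B)
... | s≤s (s≤s ())

pair-covered : ∀ (G : Graph n) → PairsInTriples G → ∀ P → ∣ P ∣ ≡ 2 → ∃ λ A → A ∈ˡ antichain G × P ⊆ A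
pair-covered G pairs P ∣P∣ with independent G P in ind
... | false = P , edge∈antichain G ∣P∣ ind , ⊆-refl
... | true with pairs P ∣P∣ ind
...   | T , P⊆T , ∣T∣ , indT = T , triple∈antichain G ∣T∣ indT , P⊆T

-- Sets of size at most 2 lie below an edge or an independent triple; larger sets
-- contain an edge or an independent triple.
antichain-isMaximal : ∀ (G : Graph n) → 2 ≤ n → PairsInTriples G → IsMaximal (antichain G)
antichain-isMaximal G 2≤n pairs X _ with ∣ X ∣ ≤? 2
... | yes ∣X∣≤2 with superset-of-size 2 X ∣X∣≤2 2≤n
...   | P , X⊆P , ∣P∣ with pair-covered G pairs P ∣P∣
...     | A , A∈ , P⊆A = A , A∈ , inj₁ (⊆-trans X⊆P P⊆A)
antichain-isMaximal G 2≤n pairs X _ | no ∣X∣≰2 with independent G X in ind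
... | false with dependent⇒edge G X ind
...   | E , E⊆X , ∣E∣ , depE = E , edge∈antichain G ∣E∣ depE , inj₂ E⊆X
antichain-isMaximal G 2≤n pairs X _ | no ∣X∣≰2 | true with subset-of-size 3 X (≰⇒> ∣X∣≰2)
... | T , T⊆X , ∣T∣ = T , triple∈antichain G ∣T∣ (independent-antimono G T⊆X ind) , inj₂ T⊆X

antichain-inS2 : ∀ (G : Graph n) → 2 ≤ n → PairsInTriples G → InS2 n (size G)
antichain-inS2 G 2≤n pairs =
  antichain G , subsetsWith-unique (inAntichain G) , antichain-isAntichain G ,
  antichain-isMaximal G 2≤n pairs , All.tabulate (Sum.map proj₁ proj₁ ∘ ∈-antichain⁻ G) ,
  length-subsetsWith (inAntichain G)

-- Counting the antichain

countSubsets-cong : ∀ {P Q : Subset n → Bool} → (∀ S → P S ≡ Q S) → countSubsets P ≡ countSubsets Q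
countSubsets-cong {zero}  P≡Q rewrite P≡Q [] = refl
countSubsets-cong {suc n} P≡Q =
  cong₂ _+_ (countSubsets-cong (P≡Q ∘ (false ∷_))) (countSubsets-cong (P≡Q ∘ (true ∷_)))

countSubsets-false : countSubsets {n} (λ _ → false) ≡ 0
countSubsets-false {zero}  = refl
countSubsets-false {suc n} = cong₂ _+_ (countSubsets-false {n}) (countSubsets-false {n})

countSubsets-∨ : ∀ (P Q : Subset n → Bool) → (∀ S → P S ∧ Q S ≡ false) →
  countSubsets (λ S → P S ∨ Q S) ≡ countSubsets P + countSubsets Q
countSubsets-∨ {zero} P Q disj with P [] | Q [] | disj []
... | false | false | _ = refl
... | false | true  | _ = refl
... | true  | false | _ = refl
countSubsets-∨ {suc n} P Q disj = begin
  countSubsets (P∨Q ∘ (false ∷_)) + countSubsets (P∨Q ∘ (true ∷_))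
    ≡⟨ cong₂ _+_ (countSubsets-∨ _ _ (disj ∘ (false ∷_))) (countSubsets-∨ _ _ (disj ∘ (true ∷_))) ⟩
  (#P₀ + #Q₀) + (#P₁ + #Q₁)
    ≡⟨ interchange #P₀ #Q₀ #P₁ #Q₁ ⟩
  (#P₀ + #P₁) + (#Q₀ + #Q₁) ∎
  where
  open ≡-Reasoning
  P∨Q = λ S → P S ∨ Q S
  #P₀ = countSubsets (P ∘ (false ∷_))
  #P₁ = countSubsets (P ∘ (true ∷_))
  #Q₀ = countSubsets (Q ∘ (false ∷_))
  #Q₁ = countSubsets (Q ∘ (true ∷_))

countSubsets-empty : ∀ (P : Subset n → Bool) →
  countSubsets (λ S → (∣ S ∣ ≡ᵇ 0) ∧ P S) ≡ (if P ⊥ then 1 else 0)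
countSubsets-empty {zero}  P = refl
countSubsets-empty {suc n} P =
  trans (cong₂ _+_ (countSubsets-empty (P ∘ (false ∷_))) (countSubsets-false {n})) (+-identityʳ _)

singletons-meeting : ∀ (R : Subset n) → countSubsets (λ S → (∣ S ∣ ≡ᵇ 1) ∧ not (disjoint R S)) ≡ ∣ R ∣
singletons-meeting []          = refl
singletons-meeting (true ∷ R)  =
  trans (cong₂ _+_ (singletons-meeting R)
                   (countSubsets-empty (λ S → not (disjoint (true ∷ R) (true ∷ S)))))
        (+-comm ∣ R ∣ 1)
singletons-meeting (false ∷ R) = begin
  countSubsets (λ S → (∣ S ∣ ≡ᵇ 1) ∧ not (disjoint R S))
    + countSubsets (λ S → (∣ S ∣ ≡ᵇ 0) ∧ not (disjoint R S))
    ≡⟨ cong₂ _+_ (singletons-meeting R) (countSubsets-empty (λ S → not (disjoint R S))) ⟩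
  ∣ R ∣ + (if not (disjoint R ⊥) then 1 else 0)
    ≡⟨ cong (λ d → ∣ R ∣ + (if not d then 1 else 0)) (disjoint-⊥ʳ R) ⟩
  ∣ R ∣ + 0 ≡⟨ +-identityʳ ∣ R ∣ ⟩
  ∣ R ∣ ∎
  where open ≡-Reasoning

singletons-avoiding : ∀ (R : Subset n) → countSubsets (λ S → (∣ S ∣ ≡ᵇ 1) ∧ disjoint R S) + ∣ R ∣ ≡ n
singletons-avoiding []          = refl
singletons-avoiding {suc n} (true ∷ R) = begin
  #avoiding + countSubsets {n} (λ S → (∣ S ∣ ≡ᵇ 0) ∧ false) + suc ∣ R ∣
    ≡⟨ cong (λ c → #avoiding + c + suc ∣ R ∣) (countSubsets-empty {n} (λ _ → false)) ⟩
  #avoiding + 0 + suc ∣ R ∣ ≡⟨ cong (_+ suc ∣ R ∣) (+-identityʳ #avoiding) ⟩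
  #avoiding + suc ∣ R ∣     ≡⟨ +-suc #avoiding ∣ R ∣ ⟩
  suc (#avoiding + ∣ R ∣)   ≡⟨ cong suc (singletons-avoiding R) ⟩
  suc n                     ∎
  where
  open ≡-Reasoning
  #avoiding = countSubsets (λ S → (∣ S ∣ ≡ᵇ 1) ∧ disjoint R S)
singletons-avoiding {suc n} (false ∷ R) = begin
  #avoiding + countSubsets (λ S → (∣ S ∣ ≡ᵇ 0) ∧ disjoint R S) + ∣ R ∣
    ≡⟨ cong (λ c → #avoiding + c + ∣ R ∣) (countSubsets-empty (disjoint R)) ⟩
  #avoiding + (if disjoint R ⊥ then 1 else 0) + ∣ R ∣
    ≡⟨ cong (λ d → #avoiding + (if d then 1 else 0) + ∣ R ∣) (disjoint-⊥ʳ R) ⟩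
  #avoiding + 1 + ∣ R ∣ ≡⟨ cong (_+ ∣ R ∣) (+-comm #avoiding 1) ⟩
  suc (#avoiding + ∣ R ∣) ≡⟨ cong suc (singletons-avoiding R) ⟩
  suc n ∎
  where
  open ≡-Reasoning
  #avoiding = countSubsets (λ S → (∣ S ∣ ≡ᵇ 1) ∧ disjoint R S)

independentPairsOutside : Subset n → Graph n → ℕ
independentPairsOutside R G = countSubsets (λ S → (∣ S ∣ ≡ᵇ 2) ∧ (disjoint R S ∧ independent G S))

independentPairs : Graph n → ℕ
independentPairs = independentPairsOutside ⊥

singleton-independent : ∀ (G : Graph n) S → ∣ S ∣ ≡ 1 → independent G S ≡ true
singleton-independent G S ∣S∣≡1 = independent-≤1 G S (≤-reflexive ∣S∣≡1)

edgeOrTriple-suc : ∀ k d i → (k ≡ 1 → i ≡ true) →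
  edgeOrTriple (suc k) (d ∧ i) ≡ ((k ≡ᵇ 1) ∧ not d) ∨ ((k ≡ᵇ 2) ∧ (d ∧ i))
edgeOrTriple-suc 0 d i _ = refl
edgeOrTriple-suc 1 false i _ = refl
edgeOrTriple-suc 1 true i i≡true rewrite i≡true refl = refl
edgeOrTriple-suc 2 d i _ = refl
edgeOrTriple-suc (suc (suc (suc k))) d i _ = refl

levels-1-2-disjoint : ∀ k a b → ((k ≡ᵇ 1) ∧ a) ∧ ((k ≡ᵇ 2) ∧ b) ≡ false
levels-1-2-disjoint 0 a b = refl
levels-1-2-disjoint 1 a b = ∧-zeroʳ a
levels-1-2-disjoint (suc (suc k)) a b = refl

-- The new vertex adds its ∣ R ∣ edges and one independent triple per independent pair outside R.
size-◃ : ∀ (R : Subset n) G → size (R ◃ G) ≡ size G + (∣ R ∣ + independentPairsOutside R G)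
size-◃ R G = cong (size G +_) (begin
  countSubsets (λ S → edgeOrTriple (suc ∣ S ∣) (disjoint R S ∧ independent G S))
    ≡⟨ countSubsets-cong (λ S → edgeOrTriple-suc ∣ S ∣ _ _ (singleton-independent G S)) ⟩
  countSubsets (λ S → meets S ∨ ((∣ S ∣ ≡ᵇ 2) ∧ (disjoint R S ∧ independent G S)))
    ≡⟨ countSubsets-∨ meets _ (λ S → levels-1-2-disjoint ∣ S ∣ _ _) ⟩
  countSubsets meets + independentPairsOutside R G
    ≡⟨ cong (_+ independentPairsOutside R G) (singletons-meeting R) ⟩
  ∣ R ∣ + independentPairsOutside R G ∎)
  where
  open ≡-Reasoning
  meets = λ S → (∣ S ∣ ≡ᵇ 1) ∧ not (disjoint R S)

singleton-pair : ∀ k d i → (k ≡ 1 → i ≡ true) → (k ≡ᵇ 1) ∧ (d ∧ i) ≡ (k ≡ᵇ 1) ∧ d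
singleton-pair 0 d i _ = refl
singleton-pair 1 d i i≡true rewrite i≡true refl = ∧-identityʳ d
singleton-pair (suc (suc k)) d i _ = refl

independentPairs-◃ : ∀ (R : Subset n) G → independentPairs (R ◃ G) + ∣ R ∣ ≡ independentPairs G + n
independentPairs-◃ {n} R G = begin
  independentPairs G + newPairs + ∣ R ∣
    ≡⟨ +-assoc (independentPairs G) newPairs ∣ R ∣ ⟩
  independentPairs G + (newPairs + ∣ R ∣)
    ≡⟨ cong (λ c → independentPairs G + (c + ∣ R ∣)) (countSubsets-cong avoidsR) ⟩
  independentPairs G + (countSubsets (λ S → (∣ S ∣ ≡ᵇ 1) ∧ disjoint R S) + ∣ R ∣)
    ≡⟨ cong (independentPairs G +_) (singletons-avoiding R) ⟩
  independentPairs G + n ∎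
  where
  open ≡-Reasoning
  newPairs = countSubsets {n} (λ S → (∣ S ∣ ≡ᵇ 1) ∧ (disjoint ⊥ S ∧ (disjoint R S ∧ independent G S)))
  avoidsR : ∀ S → (∣ S ∣ ≡ᵇ 1) ∧ (disjoint ⊥ S ∧ (disjoint R S ∧ independent G S))
                ≡ (∣ S ∣ ≡ᵇ 1) ∧ disjoint R S
  avoidsR S rewrite disjoint-⊥ˡ S = singleton-pair ∣ S ∣ _ _ (singleton-independent G S)

independentPairsOutside-∷ : ∀ (R R₀ : Subset n) G →
  independentPairsOutside (true ∷ R) (R₀ ◃ G) ≡ independentPairsOutside R G
independentPairsOutside-∷ {n} R R₀ G = begin
  independentPairsOutside R G + countSubsets {n} (λ S → (∣ S ∣ ≡ᵇ 1) ∧ false)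
    ≡⟨ cong (independentPairsOutside R G +_) (countSubsets-cong {n} (λ S → ∧-zeroʳ (∣ S ∣ ≡ᵇ 1))) ⟩
  independentPairsOutside R G + countSubsets {n} (λ _ → false)
    ≡⟨ cong (independentPairsOutside R G +_) (countSubsets-false {n}) ⟩
  independentPairsOutside R G + 0
    ≡⟨ +-identityʳ _ ⟩
  independentPairsOutside R G ∎
  where open ≡-Reasoning

independentPairsOutside-⊤ : ∀ (G : Graph n) → independentPairsOutside ⊤ G ≡ 0
independentPairsOutside-⊤ ∅       = refl
independentPairsOutside-⊤ (R ◃ G) = trans (independentPairsOutside-∷ ⊤ R G) (independentPairsOutside-⊤ G)

size-⊤◃ : ∀ (G : Graph n) → size (⊤ ◃ G) ≡ size G + n
size-⊤◃ {n} G = trans (size-◃ ⊤ G)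
  (cong (size G +_) (trans (cong₂ _+_ (∣⊤∣≡n n) (independentPairsOutside-⊤ G)) (+-identityʳ n)))

Realizable : ℕ → ℕ → Set
Realizable n m = Σ (Graph n) λ G → PairsInTriples G × size G ≡ m

PairsInTriples-⊤◃ : ∀ (G : Graph n) → PairsInTriples G → PairsInTriples (⊤ ◃ G)
PairsInTriples-⊤◃ G pairs (false ∷ S) ∣S∣ indS with pairs S ∣S∣ indS
... | T , S⊆T , ∣T∣ , indT = false ∷ T , s⊆s S⊆T , ∣T∣ , indT
PairsInTriples-⊤◃ G pairs (true ∷ S) ∣S∣ indS
  with trans (sym indS) (cong (_∧ independent G S) (disjoint-⊤ S (≤-reflexive (sym (suc-injective ∣S∣)))))
... | ()

Realizable-⊤◃ : ∀ {m} → Realizable n m → Realizable (suc n) (m + n)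
Realizable-⊤◃ {n} (G , pairs , sizeG) =
  ⊤ ◃ G , PairsInTriples-⊤◃ G pairs , trans (size-⊤◃ G) (cong (_+ n) sizeG)

NoDominatingVertex : Graph n → Set
NoDominatingVertex {n} G = ∀ (S : Subset n) → ∣ S ∣ ≡ 1 →
  ∃ λ P → S ⊆ P × ∣ P ∣ ≡ 2 × independent G P ≡ true

PairsInTriples-⊥◃ : ∀ (G : Graph n) → NoDominatingVertex G → PairsInTriples (⊥ ◃ G)
PairsInTriples-⊥◃ G _ (false ∷ S) ∣S∣ indS =
  true ∷ S , out⊆ ⊆-refl , cong suc ∣S∣ , cong₂ _∧_ (disjoint-⊥ˡ S) indS
PairsInTriples-⊥◃ G noDom (true ∷ S) ∣S∣ _ with noDom S (suc-injective ∣S∣)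
... | P , S⊆P , ∣P∣ , indP = true ∷ P , in⊆in S⊆P , cong suc ∣P∣ , cong₂ _∧_ (disjoint-⊥ˡ P) indP

NoDominatingVertex-◃ : ∀ (R : Subset n) (G : Graph n) {j} → j ∉ R →
  NoDominatingVertex G → NoDominatingVertex (R ◃ G)
NoDominatingVertex-◃ R G _ noDom (false ∷ S) ∣S∣ with noDom S ∣S∣
... | P , S⊆P , ∣P∣ , indP = false ∷ P , s⊆s S⊆P , ∣P∣ , indP
NoDominatingVertex-◃ R G {j} j∉R _ (true ∷ S) ∣S∣ with ∣p∣≡0⇒p≡⊥ {S = S} (suc-injective ∣S∣)
... | refl = true ∷ ⁅ j ⁆ , in⊆in (⊆-min _) , cong suc (∣⁅x⁆∣≡1 j) ,
             cong₂ _∧_ (disjoint-∉ R j∉R) (singleton-independent G ⁅ j ⁆ (∣⁅x⁆∣≡1 j))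

NoDominatingVertex-⊥◃ : ∀ (G : Graph n) → 1 ≤ n → NoDominatingVertex (⊥ ◃ G)
NoDominatingVertex-⊥◃ G _ (false ∷ S) ∣S∣ =
  true ∷ S , out⊆ ⊆-refl , cong suc ∣S∣ , cong₂ _∧_ (disjoint-⊥ˡ S) (singleton-independent G S ∣S∣)
NoDominatingVertex-⊥◃ {suc n} G _ (true ∷ S) ∣S∣ with ∣p∣≡0⇒p≡⊥ {S = S} (suc-injective ∣S∣)
... | refl = true ∷ ⁅ zero ⁆ , in⊆in (⊆-min _) , cong suc (∣⁅x⁆∣≡1 {suc n} zero) ,
             cong₂ _∧_ (disjoint-⊥ˡ {suc n} ⁅ zero ⁆)
                       (singleton-independent G ⁅ zero ⁆ (∣⁅x⁆∣≡1 {suc n} zero))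

-- Edges and paths of length two

C₂ : ℕ → ℕ
C₂ zero    = 0
C₂ (suc n) = C₂ n + n

C₃ : ℕ → ℕ
C₃ zero    = 0
C₃ (suc n) = C₃ n + C₂ n

C₂-+ : ∀ a b → C₂ (a + b) ≡ C₂ a + C₂ b + a * b
C₂-+ zero    b = sym (+-identityʳ (C₂ b))
C₂-+ (suc a) b = begin
  C₂ (a + b) + (a + b)          ≡⟨ cong (_+ (a + b)) (C₂-+ a b) ⟩
  C₂ a + C₂ b + a * b + (a + b) ≡⟨ rearrange (C₂ a) (C₂ b) a b ⟩
  C₂ a + a + C₂ b + suc a * b   ∎
  where
  open ≡-Reasoning
  rearrange : ∀ x y a b → x + y + a * b + (a + b) ≡ x + a + y + suc a * b
  rearrange = solve-∀

C₂-mono : ∀ {m n} → m ≤ n → C₂ m ≤ C₂ n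
C₂-mono {n = n} z≤n = z≤n
C₂-mono (s≤s m≤n) = +-mono-≤ (C₂-mono m≤n) m≤n

C₂-double : ∀ l → C₂ (suc l) + C₂ (suc l) ≡ suc l * l
C₂-double zero    = refl
C₂-double (suc l) = begin
  (C₂ (suc l) + suc l) + (C₂ (suc l) + suc l) ≡⟨ interchange (C₂ (suc l)) (suc l) (C₂ (suc l)) (suc l) ⟩
  (C₂ (suc l) + C₂ (suc l)) + (suc l + suc l) ≡⟨ cong (_+ (suc l + suc l)) (C₂-double l) ⟩
  suc l * l + (suc l + suc l)                 ≡⟨ expand l ⟩
  suc (suc l) * suc l                         ∎
  where
  open ≡-Reasoning
  expand : ∀ l → suc l * l + (suc l + suc l) ≡ suc (suc l) * suc l
  expand = solve-∀

-- e is the number of edges. For the forests built below s is the number of paths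
-- with two edges, and the second equation says size G = C(n,3) − e(n−3) + s.
Profile : Graph n → ℕ → ℕ → Set
Profile {n} G e s = independentPairs G + e ≡ C₂ n × size G + e * n ≡ C₃ n + 3 * e + s

addIsolated : ∀ l → Graph n → Graph (l + n)
addIsolated zero    G = G
addIsolated (suc l) G = ⊥ ◃ addIsolated l G

Profile-⊥◃ : ∀ (G : Graph n) {e s} → Profile G e s → Profile (⊥ ◃ G) e s
Profile-⊥◃ {n} G {e} {s} (pairsG , sizeG) = pairs , size′
  where
  open ≡-Reasoning
  newPairs : independentPairs (⊥ ◃ G) ≡ independentPairs G + n
  newPairs = begin
    independentPairs (⊥ ◃ G)           ≡⟨ +-identityʳ _ ⟨
    independentPairs (⊥ ◃ G) + 0       ≡⟨ cong (independentPairs (⊥ ◃ G) +_) (∣⊥∣≡0 n) ⟨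
    independentPairs (⊥ ◃ G) + ∣ ⊥ {n} ∣ ≡⟨ independentPairs-◃ ⊥ G ⟩
    independentPairs G + n             ∎
  newSize : size (⊥ ◃ G) ≡ size G + independentPairs G
  newSize = trans (size-◃ ⊥ G) (cong (λ d → size G + (d + independentPairs G)) (∣⊥∣≡0 n))
  pairs : independentPairs (⊥ ◃ G) + e ≡ C₂ n + n
  pairs = begin
    independentPairs (⊥ ◃ G) + e  ≡⟨ cong (_+ e) newPairs ⟩
    independentPairs G + n + e    ≡⟨ xy∙z≈xz∙y (independentPairs G) n e ⟩
    independentPairs G + e + n    ≡⟨ cong (_+ n) pairsG ⟩
    C₂ n + n                      ∎
  size′ : size (⊥ ◃ G) + e * suc n ≡ C₃ n + C₂ n + 3 * e + s
  size′ = begin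
    size (⊥ ◃ G) + e * suc n                       ≡⟨ cong (_+ e * suc n) newSize ⟩
    size G + independentPairs G + e * suc n        ≡⟨ regroup (size G) (independentPairs G) e n ⟩
    (size G + e * n) + (independentPairs G + e)    ≡⟨ cong₂ _+_ sizeG pairsG ⟩
    C₃ n + 3 * e + s + C₂ n                        ≡⟨ regroup′ (C₃ n) e s (C₂ n) ⟩
    C₃ n + C₂ n + 3 * e + s                        ∎
    where
    regroup : ∀ a b e n → a + b + e * suc n ≡ (a + e * n) + (b + e)
    regroup = solve-∀
    regroup′ : ∀ a e s b → a + 3 * e + s + b ≡ a + b + 3 * e + s
    regroup′ = solve-∀

Profile-addIsolated : ∀ l (G : Graph n) {e s} → Profile G e s → Profile (addIsolated l G) e s
Profile-addIsolated zero    G p = p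
Profile-addIsolated (suc l) G p = Profile-⊥◃ (addIsolated l G) (Profile-addIsolated l G p)

NoDominatingVertex-addIsolated : ∀ l (G : Graph n) → 1 ≤ n → NoDominatingVertex G →
  NoDominatingVertex (addIsolated l G)
NoDominatingVertex-addIsolated zero        G _   noDom = noDom
NoDominatingVertex-addIsolated {n} (suc l) G 1≤n _     =
  NoDominatingVertex-⊥◃ (addIsolated l G) (≤-trans 1≤n (m≤n+m n l))

-- A new spine vertex is joined to l fresh leaves and to the previous top vertex.
legsAndTop : ∀ l → Subset (l + suc n)
legsAndTop zero    = true ∷ ⊥
legsAndTop (suc l) = true ∷ legsAndTop l

∣legsAndTop∣ : ∀ l → ∣ legsAndTop {n} l ∣ ≡ suc l
∣legsAndTop∣ {n} zero = cong suc (∣⊥∣≡0 n)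
∣legsAndTop∣ (suc l)  = cong suc (∣legsAndTop∣ l)

spineStep : ∀ l → Subset h → Graph h → Graph (suc (l + suc h))
spineStep l R H = legsAndTop l ◃ addIsolated l (R ◃ H)

independentPairsOutside-legsAndTop : ∀ l (R : Subset h) H →
  independentPairsOutside (legsAndTop l) (addIsolated l (R ◃ H)) ≡ independentPairs H
independentPairsOutside-legsAndTop zero    R H = independentPairsOutside-∷ ⊥ R H
independentPairsOutside-legsAndTop (suc l) R H =
  trans (independentPairsOutside-∷ (legsAndTop l) ⊥ (addIsolated l (R ◃ H)))
        (independentPairsOutside-legsAndTop l R H)

C₂-legs : ∀ l h → C₂ (l + suc h) ≡ C₂ h + C₂ (suc l) + h * suc l
C₂-legs l h = trans (cong C₂ (trans (+-comm l (suc h)) (sym (+-suc h l)))) (C₂-+ h (suc l))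

spineStep-arithmetic : ∀ C₃N {C₂N} eH d s C₂h c l h → C₂N ≡ C₂h + c + h * suc l → c + c ≡ suc l * l →
  C₃N + 3 * (eH + d) + s + C₂h + (eH + d + suc l) * suc (suc (l + h)) + suc l
    ≡ C₃N + C₂N + 3 * (eH + d + suc l) + (s + c + d) + ((eH + d) * suc (l + h) + eH)
spineStep-arithmetic C₃N eH d s C₂h c l h refl cc =
  +-cancelʳ-≡ (c + c) _ _ (trans (identity C₃N eH d s C₂h l h c) (cong (rhs +_) (sym cc)))
  where
  rhs = C₃N + (C₂h + c + h * suc l) + 3 * (eH + d + suc l) + (s + c + d) + ((eH + d) * suc (l + h) + eH)
  identity : ∀ C₃N eH d s C₂h l h c →
    C₃N + 3 * (eH + d) + s + C₂h + (eH + d + suc l) * suc (suc (l + h)) + suc l + (c + c)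
      ≡ C₃N + (C₂h + c + h * suc l) + 3 * (eH + d + suc l) + (s + c + d) + ((eH + d) * suc (l + h) + eH)
        + suc l * l
  identity = solve-∀

-- eH is the number of edges of H.
Profile-spineStep : ∀ l (R : Subset h) H {eH s} → independentPairs H + eH ≡ C₂ h →
  Profile (R ◃ H) (eH + ∣ R ∣) s →
  Profile (spineStep l R H) (eH + ∣ R ∣ + suc l) (s + C₂ (suc l) + ∣ R ∣)
Profile-spineStep {h} l R H {eH} {s} pairsH profile = pairs , size′
  where
  open ≡-Reasoning
  e = eH + ∣ R ∣
  N = l + suc h
  G = addIsolated l (R ◃ H)
  G′ = spineStep l R H
  profileG : Profile G e s
  profileG = Profile-addIsolated l (R ◃ H) profile
  newSize : size G′ ≡ size G + (suc l + independentPairs H)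
  newSize = trans (size-◃ (legsAndTop l) G)
    (cong₂ (λ a b → size G + (a + b)) (∣legsAndTop∣ l) (independentPairsOutside-legsAndTop l R H))
  newPairs : independentPairs G′ + suc l ≡ independentPairs G + N
  newPairs = trans (cong (independentPairs G′ +_) (sym (∣legsAndTop∣ l)))
                   (independentPairs-◃ (legsAndTop l) G)
  pairs : independentPairs G′ + (e + suc l) ≡ C₂ N + N
  pairs = begin
    independentPairs G′ + (e + suc l) ≡⟨ x∙yz≈xz∙y (independentPairs G′) e (suc l) ⟩
    independentPairs G′ + suc l + e   ≡⟨ cong (_+ e) newPairs ⟩
    independentPairs G + N + e        ≡⟨ xy∙z≈xz∙y (independentPairs G) N e ⟩
    independentPairs G + e + N        ≡⟨ cong (_+ N) (proj₁ profileG) ⟩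
    C₂ N + N                          ∎
  size′ : size G′ + (e + suc l) * suc N ≡ C₃ N + C₂ N + 3 * (e + suc l) + (s + C₂ (suc l) + ∣ R ∣)
  size′ = +-cancelʳ-≡ (e * N + eH) _ _ (begin
    size G′ + (e + suc l) * suc N + (e * N + eH)
      ≡⟨ cong (λ x → x + (e + suc l) * suc N + (e * N + eH)) newSize ⟩
    size G + (suc l + independentPairs H) + (e + suc l) * suc N + (e * N + eH)
      ≡⟨ regroup (size G) (independentPairs H) e l N eH ⟩
    (size G + e * N) + (independentPairs H + eH) + (e + suc l) * suc N + suc l
      ≡⟨ cong₂ (λ x y → x + y + (e + suc l) * suc N + suc l) (proj₂ profileG) pairsH ⟩
    C₃ N + 3 * e + s + C₂ h + (e + suc l) * suc N + suc l
      ≡⟨ cong (λ x → C₃ N + 3 * e + s + C₂ h + (e + suc l) * suc x + suc l) (+-suc l h) ⟩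
    C₃ N + 3 * e + s + C₂ h + (e + suc l) * suc (suc (l + h)) + suc l
      ≡⟨ spineStep-arithmetic (C₃ N) eH ∣ R ∣ s (C₂ h) (C₂ (suc l)) l h (C₂-legs l h) (C₂-double l) ⟩
    C₃ N + C₂ N + 3 * (e + suc l) + (s + C₂ (suc l) + ∣ R ∣) + (e * suc (l + h) + eH)
      ≡⟨ cong (λ x → C₃ N + C₂ N + 3 * (e + suc l) + (s + C₂ (suc l) + ∣ R ∣) + (e * x + eH)) (+-suc l h) ⟨
    C₃ N + C₂ N + 3 * (e + suc l) + (s + C₂ (suc l) + ∣ R ∣) + (e * N + eH) ∎)
    where
    regroup : ∀ a i e l N eH → a + (suc l + i) + (e + suc l) * suc N + (e * N + eH)
                             ≡ (a + e * N) + (i + eH) + (e + suc l) * suc N + suc l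
    regroup = solve-∀

addMatching : ∀ a → Graph n → Graph (a * 2 + n)
addMatching zero    G = G
addMatching (suc a) G = spineStep 0 ⊥ (addMatching a G)

Profile-addMatching : ∀ a (G : Graph n) {e s} → Profile G e s → Profile (addMatching a G) (e + a) s
Profile-addMatching zero G {e} {s} profile = subst (λ x → Profile G x s) (sym (+-identityʳ e)) profile
Profile-addMatching {n} (suc a) G {e} {s} profile =
  subst₂ (Profile (addMatching (suc a) G)) edges paths
    (Profile-spineStep 0 ⊥ M (proj₁ profileM)
      (subst (λ x → Profile (⊥ ◃ M) x s) (sym edgesM) (Profile-⊥◃ M profileM)))
  where
  M = addMatching a G
  profileM = Profile-addMatching a G profile
  ∣⊥∣≡0′ = ∣⊥∣≡0 (a * 2 + n)
  edgesM : e + a + ∣ ⊥ {a * 2 + n} ∣ ≡ e + a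
  edgesM = trans (cong (e + a +_) ∣⊥∣≡0′) (+-identityʳ _)
  edges : e + a + ∣ ⊥ {a * 2 + n} ∣ + 1 ≡ e + suc a
  edges = trans (cong (_+ 1) edgesM) (trans (+-assoc e a 1) (cong (e +_) (+-comm a 1)))
  paths : s + 0 + ∣ ⊥ {a * 2 + n} ∣ ≡ s
  paths = trans (cong (s + 0 +_) ∣⊥∣≡0′) (trans (+-identityʳ _) (+-identityʳ s))

NoDominatingVertex-pendantEdge : ∀ (G : Graph n) → 1 ≤ n → NoDominatingVertex ((true ∷ ⊥) ◃ ⊥ ◃ G)
NoDominatingVertex-pendantEdge {suc n} G _ =
  NoDominatingVertex-◃ (true ∷ ⊥) (⊥ ◃ G) {suc zero} (λ { (there x∈⊥) → ∉⊥ x∈⊥ })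
    (NoDominatingVertex-⊥◃ G (s≤s z≤n))

NoDominatingVertex-addMatching : ∀ a (G : Graph n) → 1 ≤ n → NoDominatingVertex (addMatching (suc a) G)
NoDominatingVertex-addMatching {n} a G 1≤n =
  NoDominatingVertex-pendantEdge (addMatching a G) (≤-trans 1≤n (m≤n+m n (a * 2)))

-- Caterpillars

-- The graph is top ◃ body; the next spine vertex will be joined to its vertex 0.
record Spine : Set where
  constructor spine
  field
    {order} : ℕ
    top     : Subset order
    body    : Graph order

graphOf : (σ : Spine) → Graph (suc (Spine.order σ))
graphOf (spine R H) = R ◃ H

grow : Spine → ℕ → Spine
grow (spine R H) l = spine (legsAndTop l) (addIsolated l (R ◃ H))

growAll : Spine → List ℕ → Spine
growAll σ []       = σ
growAll σ (l ∷ ls) = growAll (grow σ l) ls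

edgesAdded : List ℕ → ℕ
edgesAdded []       = 0
edgesAdded (l ∷ ls) = suc l + edgesAdded ls

-- d is the current degree of the top vertex.
pathsAdded : ℕ → List ℕ → ℕ
pathsAdded d []       = 0
pathsAdded d (l ∷ ls) = C₂ (suc l) + d + pathsAdded (suc l) ls

SpineProfile : Spine → ℕ → ℕ → Set
SpineProfile (spine {h} R H) e s =
  Σ ℕ λ eH → independentPairs H + eH ≡ C₂ h × e ≡ eH + ∣ R ∣ × Profile (R ◃ H) e s

SpineProfile-grow : ∀ σ l {e s} → SpineProfile σ e s →
  SpineProfile (grow σ l) (e + suc l) (s + C₂ (suc l) + ∣ Spine.top σ ∣)
SpineProfile-grow (spine R H) l {e} (eH , pairsH , refl , profile) =
  e , proj₁ (Profile-addIsolated l (R ◃ H) profile) , cong (e +_) (sym (∣legsAndTop∣ l)) ,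
  Profile-spineStep l R H pairsH profile

SpineProfile-growAll : ∀ σ ls {e s} → SpineProfile σ e s →
  SpineProfile (growAll σ ls) (e + edgesAdded ls) (s + pathsAdded ∣ Spine.top σ ∣ ls)
SpineProfile-growAll σ [] {e} {s} profile =
  subst₂ (SpineProfile σ) (sym (+-identityʳ e)) (sym (+-identityʳ s)) profile
SpineProfile-growAll σ (l ∷ ls) {e} {s} profile =
  subst₂ (SpineProfile (growAll (grow σ l) ls)) (+-assoc e (suc l) (edgesAdded ls)) pathsEq
    (SpineProfile-growAll (grow σ l) ls (SpineProfile-grow σ l profile))
  where
  d = ∣ Spine.top σ ∣
  regroup : ∀ a b c d → a + b + c + d ≡ a + (b + c + d)
  regroup = solve-∀
  pathsEq : s + C₂ (suc l) + d + pathsAdded ∣ Spine.top (grow σ l) ∣ ls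
          ≡ s + (C₂ (suc l) + d + pathsAdded (suc l) ls)
  pathsEq = trans (cong (λ x → s + C₂ (suc l) + d + pathsAdded x ls) (∣legsAndTop∣ l))
                  (regroup s (C₂ (suc l)) d (pathsAdded (suc l) ls))

point : Spine
point = spine [] ∅

SpineProfile-point : SpineProfile point 0 0
SpineProfile-point = 0 , refl , refl , refl , refl

order-growAll : ∀ σ ls → Spine.order (growAll σ ls) ≡ Spine.order σ + edgesAdded ls
order-growAll σ []       = sym (+-identityʳ _)
order-growAll σ (l ∷ ls) = trans (order-growAll (grow σ l) ls) (regroup l (Spine.order σ) (edgesAdded ls))
  where
  regroup : ∀ l h x → l + suc h + x ≡ h + (suc l + x)
  regroup = solve-∀

Profile-graphOf : ∀ σ {e s} → SpineProfile σ e s → Profile (graphOf σ) e s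
Profile-graphOf (spine R H) (_ , _ , _ , profile) = profile

firstBodyVertex : ∀ l h → Fin (l + suc (suc h))
firstBodyVertex zero    h = suc zero
firstBodyVertex (suc l) h = suc (firstBodyVertex l h)

firstBodyVertex∉legsAndTop : ∀ l h → firstBodyVertex l h ∉ legsAndTop {suc h} l
firstBodyVertex∉legsAndTop zero    h (there x∈⊥) = ∉⊥ x∈⊥
firstBodyVertex∉legsAndTop (suc l) h (there x∈)  = firstBodyVertex∉legsAndTop l h x∈

1≤order-grow : ∀ σ l → 1 ≤ Spine.order (grow σ l)
1≤order-grow (spine {h} R H) l = ≤-trans (s≤s z≤n) (m≤n+m (suc h) l)

NoDominatingVertex-grow : ∀ σ l → 1 ≤ Spine.order σ → NoDominatingVertex (graphOf σ) →
  NoDominatingVertex (graphOf (grow σ l))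
NoDominatingVertex-grow (spine {suc h} R H) l _ noDom =
  NoDominatingVertex-◃ (legsAndTop l) (addIsolated l (R ◃ H)) (firstBodyVertex∉legsAndTop l h)
    (NoDominatingVertex-addIsolated l (R ◃ H) (s≤s z≤n) noDom)

-- Needs no hypothesis on σ: a fresh leaf is a non-neighbour of every old vertex.
NoDominatingVertex-grow-suc : ∀ σ l → 1 ≤ Spine.order σ → NoDominatingVertex (graphOf (grow σ (suc l)))
NoDominatingVertex-grow-suc (spine {suc h} R H) l _ =
  NoDominatingVertex-◃ (legsAndTop (suc l)) (addIsolated (suc l) (R ◃ H))
    (firstBodyVertex∉legsAndTop (suc l) h)
    (NoDominatingVertex-⊥◃ (addIsolated l (R ◃ H)) (≤-trans (s≤s z≤n) (m≤n+m (suc (suc h)) l)))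

NoDominatingVertex-growAll : ∀ σ ls → 1 ≤ Spine.order σ → NoDominatingVertex (graphOf σ) →
  NoDominatingVertex (graphOf (growAll σ ls))
NoDominatingVertex-growAll σ []       _     noDom = noDom
NoDominatingVertex-growAll σ (l ∷ ls) 1≤ord noDom =
  NoDominatingVertex-growAll (grow σ l) ls (1≤order-grow σ l) (NoDominatingVertex-grow σ l 1≤ord noDom)

NoDominatingVertex-growAll-Any : ∀ σ ls → 1 ≤ Spine.order σ → Any (1 ≤_) ls →
  NoDominatingVertex (graphOf (growAll σ ls))
NoDominatingVertex-growAll-Any σ (suc l ∷ ls) 1≤ord (here _) =
  NoDominatingVertex-growAll (grow σ (suc l)) ls (1≤order-grow σ (suc l))
    (NoDominatingVertex-grow-suc σ l 1≤ord)
NoDominatingVertex-growAll-Any σ (l ∷ ls) _ (there some) =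
  NoDominatingVertex-growAll-Any (grow σ l) ls (1≤order-grow σ l) some

-- A spine vertex with l legs has l + 2 neighbours, hence C(l+1,2) more paths of
-- length two than an inner vertex of a path: 1, 3 and 6 for l = 1, 2, 3.
excessLegs : ℕ → List ℕ
excessLegs 0 = []
excessLegs 1 = 1 ∷ []
excessLegs 2 = 1 ∷ 1 ∷ []
excessLegs 3 = 2 ∷ []
excessLegs 4 = 2 ∷ 1 ∷ []
excessLegs 5 = 2 ∷ 1 ∷ 1 ∷ []
excessLegs (suc (suc (suc (suc (suc (suc X)))))) = 3 ∷ excessLegs X

legCost : ℕ → ℕ
legCost X = edgesAdded (excessLegs X)

spinePaths : List ℕ → ℕ
spinePaths []       = 0
spinePaths (l ∷ ls) = C₂ (suc (suc l)) + spinePaths ls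

spinePaths-excessLegs : ∀ X → spinePaths (excessLegs X) ≡ legCost X + X
spinePaths-excessLegs 0 = refl
spinePaths-excessLegs 1 = refl
spinePaths-excessLegs 2 = refl
spinePaths-excessLegs 3 = refl
spinePaths-excessLegs 4 = refl
spinePaths-excessLegs 5 = refl
spinePaths-excessLegs (suc (suc (suc (suc (suc (suc X)))))) =
  trans (cong (10 +_) (spinePaths-excessLegs X)) (regroup (legCost X) X)
  where
  regroup : ∀ c X → 10 + (c + X) ≡ 4 + c + (6 + X)
  regroup = solve-∀

legCost≤ : ∀ X → legCost X ≤ X + 2
legCost≤ 0 = z≤n
legCost≤ 1 = s≤s (s≤s z≤n)
legCost≤ 2 = ≤-refl
legCost≤ 3 = s≤s (s≤s (s≤s z≤n))
legCost≤ 4 = s≤s (s≤s (s≤s (s≤s (s≤s z≤n))))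
legCost≤ 5 = ≤-refl
legCost≤ (suc (suc (suc (suc (suc (suc X)))))) =
  ≤-trans (+-monoʳ-≤ 4 (legCost≤ X)) (≤-trans (m≤n+m (4 + (X + 2)) 2) (≤-reflexive (regroup X)))
  where
  regroup : ∀ X → 2 + (4 + (X + 2)) ≡ 6 + X + 2
  regroup = solve-∀

legCost-6+ : ∀ X → legCost (6 + X) ≤ 6 + X
legCost-6+ X = ≤-trans (+-monoʳ-≤ 4 (legCost≤ X)) (≤-reflexive (regroup X))
  where
  regroup : ∀ X → 4 + (X + 2) ≡ 6 + X
  regroup = solve-∀

legCost≤-bound : ∀ {X k} → 7 ≤ k → X ≤ k → legCost X ≤ k
legCost≤-bound {X} {k} 7≤k X≤k with X ≤? 5
... | yes X≤5 = ≤-trans (legCost≤ X) (≤-trans (+-monoˡ-≤ 2 X≤5) 7≤k)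
... | no  X≰5 with m≤n⇒∃[o]m+o≡n (≰⇒> X≰5)
...   | o , refl = ≤-trans (legCost-6+ o) X≤k

excessLegs-positive : ∀ X → Any (1 ≤_) (excessLegs (suc X))
excessLegs-positive 0 = here (s≤s z≤n)
excessLegs-positive 1 = here (s≤s z≤n)
excessLegs-positive 2 = here (s≤s z≤n)
excessLegs-positive 3 = here (s≤s z≤n)
excessLegs-positive 4 = here (s≤s z≤n)
excessLegs-positive (suc (suc (suc (suc (suc X))))) = here (s≤s z≤n)

edgesAdded-++ : ∀ xs ys → edgesAdded (xs ++ ys) ≡ edgesAdded xs + edgesAdded ys
edgesAdded-++ []       ys = refl
edgesAdded-++ (x ∷ xs) ys = trans (cong (suc x +_) (edgesAdded-++ xs ys)) (sym (+-assoc (suc x) _ _))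

spinePaths-++ : ∀ xs ys → spinePaths (xs ++ ys) ≡ spinePaths xs + spinePaths ys
spinePaths-++ []       ys = refl
spinePaths-++ (x ∷ xs) ys =
  trans (cong (C₂ (suc (suc x)) +_) (spinePaths-++ xs ys)) (sym (+-assoc (C₂ (suc (suc x))) _ _))

edgesAdded-replicate : ∀ p → edgesAdded (replicate p 0) ≡ p
edgesAdded-replicate zero    = refl
edgesAdded-replicate (suc p) = cong suc (edgesAdded-replicate p)

spinePaths-replicate : ∀ p → spinePaths (replicate p 0) ≡ p
spinePaths-replicate zero    = refl
spinePaths-replicate (suc p) = cong suc (spinePaths-replicate p)

-- Ending with a vertex without legs makes every earlier spine vertex an inner one.
pathsAdded-leaf : ∀ d ls → pathsAdded d (ls ++ [ 0 ]) ≡ d + spinePaths ls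
pathsAdded-leaf d []       = refl
pathsAdded-leaf d (l ∷ ls) =
  trans (cong (C₂ (suc l) + d +_) (pathsAdded-leaf (suc l) ls)) (regroup (C₂ (suc l)) d l (spinePaths ls))
  where
  regroup : ∀ c d l x → c + d + (suc l + x) ≡ d + (c + suc l + x)
  regroup = solve-∀

caterpillarLegs : ℕ → ℕ → List ℕ
caterpillarLegs p X = replicate p 0 ++ excessLegs X

caterpillar : ℕ → ℕ → Spine
caterpillar p X = growAll point (caterpillarLegs p X ++ [ 0 ])

edgesAdded-caterpillarLegs : ∀ p X → edgesAdded (caterpillarLegs p X ++ [ 0 ]) ≡ suc (p + legCost X)
edgesAdded-caterpillarLegs p X = begin
  edgesAdded (caterpillarLegs p X ++ [ 0 ])  ≡⟨ edgesAdded-++ (caterpillarLegs p X) [ 0 ] ⟩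
  edgesAdded (caterpillarLegs p X) + 1       ≡⟨ cong (_+ 1) (edgesAdded-++ (replicate p 0) (excessLegs X)) ⟩
  edgesAdded (replicate p 0) + legCost X + 1 ≡⟨ cong (λ x → x + legCost X + 1) (edgesAdded-replicate p) ⟩
  p + legCost X + 1                          ≡⟨ +-comm _ 1 ⟩
  suc (p + legCost X)                        ∎
  where open ≡-Reasoning

pathsAdded-caterpillarLegs : ∀ p X → pathsAdded 0 (caterpillarLegs p X ++ [ 0 ]) ≡ p + legCost X + X
pathsAdded-caterpillarLegs p X = begin
  pathsAdded 0 (caterpillarLegs p X ++ [ 0 ])   ≡⟨ pathsAdded-leaf 0 (caterpillarLegs p X) ⟩
  spinePaths (caterpillarLegs p X)              ≡⟨ spinePaths-++ (replicate p 0) (excessLegs X) ⟩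
  spinePaths (replicate p 0) + spinePaths (excessLegs X)
    ≡⟨ cong₂ _+_ (spinePaths-replicate p) (spinePaths-excessLegs X) ⟩
  p + (legCost X + X)                           ≡⟨ +-assoc p (legCost X) X ⟨
  p + legCost X + X                             ∎
  where open ≡-Reasoning

SpineProfile-caterpillar : ∀ p X → SpineProfile (caterpillar p X) (suc (p + legCost X)) (p + legCost X + X)
SpineProfile-caterpillar p X =
  subst₂ (SpineProfile (caterpillar p X)) (edgesAdded-caterpillarLegs p X) (pathsAdded-caterpillarLegs p X)
    (SpineProfile-growAll point (caterpillarLegs p X ++ [ 0 ]) SpineProfile-point)

order-caterpillar : ∀ p X → Spine.order (caterpillar p X) ≡ suc (p + legCost X)
order-caterpillar p X =
  trans (order-growAll point (caterpillarLegs p X ++ [ 0 ])) (edgesAdded-caterpillarLegs p X)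

NoDominatingVertex-caterpillar : ∀ p X → NoDominatingVertex (graphOf (caterpillar (suc p) (suc X)))
NoDominatingVertex-caterpillar p X =
  NoDominatingVertex-growAll-Any (grow point 0) (caterpillarLegs p (suc X) ++ [ 0 ]) (s≤s z≤n)
    (Any.++⁺ˡ (Any.++⁺ʳ (replicate p 0) (excessLegs-positive X)))

-- Forests

forest : ∀ p X a w → Graph (suc (w + (a * 2 + suc (Spine.order (caterpillar p X)))))
forest p X a w = ⊥ ◃ addIsolated w (addMatching a (graphOf (caterpillar p X)))

forestEdges : ℕ → ℕ → ℕ → ℕ
forestEdges p X a = suc (p + legCost X) + a

forestPaths : ℕ → ℕ → ℕ
forestPaths p X = p + legCost X + X

Profile-forest : ∀ p X a w → Profile (forest p X a w) (forestEdges p X a) (forestPaths p X)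
Profile-forest p X a w =
  Profile-⊥◃ (addIsolated w M) (Profile-addIsolated w M (Profile-addMatching a T
    (Profile-graphOf (caterpillar p X) (SpineProfile-caterpillar p X))))
  where
  T = graphOf (caterpillar p X)
  M = addMatching a T

-- Otherwise the forest without its last isolated vertex may be a star, and then the centre
-- and the isolated vertex lie in no independent triple.
Undominated : ℕ → ℕ → ℕ → ℕ → Set
Undominated p X a w = 1 ≤ w ⊎ 1 ≤ a ⊎ (1 ≤ p × 1 ≤ X)

NoDominatingVertex-forest : ∀ p X a w → Undominated p X a w →
  NoDominatingVertex (addIsolated w (addMatching a (graphOf (caterpillar p X))))
NoDominatingVertex-forest p X a (suc w) _ =
  NoDominatingVertex-⊥◃ (addIsolated w (addMatching a (graphOf (caterpillar p X))))
    (≤-trans (s≤s z≤n) (≤-trans (m≤n+m (suc (Spine.order (caterpillar p X))) (a * 2)) (m≤n+m _ w)))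
NoDominatingVertex-forest p X (suc a) zero _ = NoDominatingVertex-addMatching a _ (s≤s z≤n)
NoDominatingVertex-forest (suc p) (suc X) zero zero _ = NoDominatingVertex-caterpillar p X
NoDominatingVertex-forest p X zero zero (inj₁ ())
NoDominatingVertex-forest p X zero zero (inj₂ (inj₁ ()))
NoDominatingVertex-forest zero X zero zero (inj₂ (inj₂ (() , _)))
NoDominatingVertex-forest (suc p) zero zero zero (inj₂ (inj₂ (_ , ())))

forest-realizable : ∀ p X a w {N m} → Undominated p X a w →
  N ≡ p + legCost X + a * 2 + w + 3 →
  m + forestEdges p X a * N ≡ C₃ N + 3 * forestEdges p X a + forestPaths p X →
  Realizable N m
forest-realizable p X a w {N} {m} undominated N≡ m≡ =
  subst (λ N → Realizable N m) (sym N≡order)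
    (forest p X a w , PairsInTriples-⊥◃ _ (NoDominatingVertex-forest p X a w undominated) , sizeF)
  where
  c = legCost X
  N≡order : N ≡ suc (w + (a * 2 + suc (Spine.order (caterpillar p X))))
  N≡order = trans N≡ (trans (regroup p c a w)
    (cong (λ k → suc (w + (a * 2 + suc k))) (sym (order-caterpillar p X))))
    where
    regroup : ∀ p c a w → p + c + a * 2 + w + 3 ≡ suc (w + (a * 2 + suc (suc (p + c))))
    regroup = solve-∀
  e = forestEdges p X a
  sizeF : size (forest p X a w) ≡ m
  sizeF = +-cancelʳ-≡ _ _ _ (trans (proj₂ (Profile-forest p X a w))
    (sym (subst (λ N → m + e * N ≡ C₃ N + 3 * e + forestPaths p X) N≡order m≡)))

forest-realizable-deficit : ∀ p X a w {L m D e s} → Undominated p X a w →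
  4 + L ≡ p + legCost X + a * 2 + w + 3 → forestEdges p X a ≡ e → forestPaths p X ≡ s →
  m + D ≡ C₃ (4 + L) → D + s ≡ e * suc L → Realizable (4 + L) m
forest-realizable-deficit p X a w {L} {m} {D} undominated N≡ refl refl m+D D+s =
  forest-realizable p X a w undominated N≡ (+-cancelʳ-≡ D _ _ (begin
    m + e * (4 + L) + D           ≡⟨ regroup m e L D ⟩
    (m + D) + 3 * e + e * suc L   ≡⟨ cong₂ (λ x y → x + 3 * e + y) m+D (sym D+s) ⟩
    C₃ (4 + L) + 3 * e + (D + s)  ≡⟨ regroup′ (C₃ (4 + L)) e D s ⟩
    C₃ (4 + L) + 3 * e + s + D    ∎))
  where
  open ≡-Reasoning
  e = forestEdges p X a
  s = forestPaths p X
  regroup : ∀ m e L D → m + e * (4 + L) + D ≡ (m + D) + 3 * e + e * suc L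
  regroup = solve-∀
  regroup′ : ∀ c e D s → c + 3 * e + (D + s) ≡ c + 3 * e + s + D
  regroup′ = solve-∀

-- Choosing the numbers of edges and of paths of length two

≤-by : ∀ {a b} t → a + t ≡ b → a ≤ b
≤-by {a} t refl = m≤m+n a t

-- A path with s + 1 edges (hence s paths of length two) and e − s − 1 ≥ 1 further disjoint edges.
pathMatching-realizable : ∀ {L m D e s} → s + 2 ≤ e → e + e ≤ s + (L + 3) →
  m + D ≡ C₃ (4 + L) → D + s ≡ e * suc L → Realizable (4 + L) m
pathMatching-realizable {L} {e = e} {s} s+2≤e fits m+D D+s
  with m≤n⇒∃[o]m+o≡n s+2≤e | m≤n⇒∃[o]m+o≡n fits
... | a , refl | w , fits≡ =
  forest-realizable-deficit s 0 (suc a) w (inj₂ (inj₁ (s≤s z≤n))) N≡ (edges s a)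
    (trans (+-identityʳ (s + 0)) (+-identityʳ s)) m+D D+s
  where
  edges : ∀ s a → suc (s + 0) + suc a ≡ s + 2 + a
  edges = solve-∀
  N≡ : 4 + L ≡ s + 0 + suc a * 2 + w + 3
  N≡ = +-cancelˡ-≡ s _ _ (trans (regroup L s a) (trans (cong (_+ 1) (sym fits≡)) (regroup′ s a w)))
    where
    regroup : ∀ L s a → s + (4 + L) ≡ s + (L + 3) + 1
    regroup = solve-∀
    regroup′ : ∀ s a w → (s + 2 + a) + (s + 2 + a) + w + 1 ≡ s + (s + 0 + suc a * 2 + w + 3)
    regroup′ = solve-∀

-- A caterpillar with e + 1 edges and e + X paths of length two, plus isolated vertices.
caterpillar-realizable : ∀ {L m D e X} → 13 ≤ L → 7 ≤ e → X ≤ e → e ≤ 1 + L →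
  (e ≡ 1 + L → 1 ≤ X × X < e) →
  m + D ≡ C₃ (4 + L) → D + (e + X) ≡ suc e * suc L → Realizable (4 + L) m
caterpillar-realizable {L} {e = e} {X} 13≤L 7≤e X≤e e≤1+L tight m+D D+s
  with m≤n⇒∃[o]m+o≡n (legCost≤-bound 7≤e X≤e) | m≤n⇒∃[o]m+o≡n e≤1+L
... | p , c+p≡e | w , e+w≡1+L =
  forest-realizable-deficit p X 0 w (undominated w e+w≡1+L) N≡ edges paths m+D D+s
  where
  c = legCost X
  p+c≡e : p + c ≡ e
  p+c≡e = trans (+-comm p c) c+p≡e
  N≡ : 4 + L ≡ p + c + 0 * 2 + w + 3
  N≡ = sym (begin
    p + c + 0 * 2 + w + 3 ≡⟨ cong (λ x → x + w + 3) (+-identityʳ (p + c)) ⟩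
    p + c + w + 3         ≡⟨ cong (λ x → x + w + 3) p+c≡e ⟩
    e + w + 3             ≡⟨ cong (_+ 3) e+w≡1+L ⟩
    1 + L + 3             ≡⟨ +-comm (1 + L) 3 ⟩
    4 + L                 ∎)
    where open ≡-Reasoning
  edges : forestEdges p X 0 ≡ suc e
  edges = trans (+-identityʳ _) (cong suc p+c≡e)
  paths : forestPaths p X ≡ e + X
  paths = cong (_+ X) p+c≡e
  undominated : ∀ w → e + w ≡ 1 + L → Undominated p X 0 w
  undominated (suc w) _        = inj₁ (s≤s z≤n)
  undominated zero    e+0≡1+L  = inj₂ (inj₂ (1≤p , 1≤X))
    where
    e≡1+L = trans (sym (+-identityʳ e)) e+0≡1+L
    1≤X = proj₁ (tight e≡1+L)
    X≤L : X ≤ L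
    X≤L = ≤-pred (subst (suc X ≤_) e≡1+L (proj₂ (tight e≡1+L)))
    c<e : c + 1 ≤ e
    c<e = subst₂ _≤_ (+-comm 1 c) (sym e≡1+L) (s≤s (legCost≤-bound (≤-trans (≤-by 6 refl) 13≤L) X≤L))
    1≤p : 1 ≤ p
    1≤p = +-cancelˡ-≤ c 1 p (subst (c + 1 ≤_) (sym c+p≡e) c<e)

-- The same caterpillar, in terms of e + 1 edges and s = e + X paths of length two.
caterpillar-realizable′ : ∀ {L m D e s} → 13 ≤ L → 8 ≤ e → e ≤ s + 1 → s + 2 ≤ e + e → e ≤ 2 + L →
  (e ≡ 2 + L → 2 + L ≤ s × s + 3 ≤ e + e) →
  m + D ≡ C₃ (4 + L) → D + s ≡ e * suc L → Realizable (4 + L) m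
caterpillar-realizable′ {L} {e = suc e′} {s} 13≤L (s≤s 7≤e′) e≤s+1 s+2≤2e (s≤s e′≤1+L) top m+D D+s
  with m≤n⇒∃[o]m+o≡n (≤-pred (subst (suc e′ ≤_) (+-comm s 1) e≤s+1))
... | X , refl = caterpillar-realizable 13≤L 7≤e′ X≤e′ e′≤1+L tight m+D D+s
  where
  X≤e′ : X ≤ e′
  X≤e′ = +-cancelˡ-≤ (e′ + 2) X e′ (subst₂ _≤_ (regroup e′ X) (regroup′ e′) s+2≤2e)
    where
    regroup : ∀ e′ X → e′ + X + 2 ≡ e′ + 2 + X
    regroup = solve-∀
    regroup′ : ∀ e′ → suc e′ + suc e′ ≡ e′ + 2 + e′
    regroup′ = solve-∀
  tight : e′ ≡ 1 + L → 1 ≤ X × X < e′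
  tight e′≡1+L with top (cong suc e′≡1+L)
  ... | 2+L≤s , s+3≤2e = 1≤X , X<e′
    where
    1≤X : 1 ≤ X
    1≤X = +-cancelˡ-≤ (1 + L) 1 X (subst₂ _≤_ (+-comm 1 (1 + L)) (cong (_+ X) e′≡1+L) 2+L≤s)
    X<e′ : X < e′
    X<e′ = +-cancelˡ-≤ (e′ + 2) (suc X) e′ (subst₂ _≤_ (regroup e′ X) (regroup′ e′) s+3≤2e)
      where
      regroup : ∀ e′ X → e′ + X + 3 ≡ e′ + 2 + suc X
      regroup = solve-∀
      regroup′ : ∀ e′ → suc e′ + suc e′ ≡ e′ + 2 + e′
      regroup′ = solve-∀

record EdgeChoice (L k D : ℕ) : Set where
  constructor edgeChoice
  field
    e s     : ℕ
    k≤e     : k ≤ e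
    fits    : e + e ≤ s + (L + 3)
    small   : s ≤ L ⊎ s + 3 ≤ e + e
    balance : D + s ≡ e * suc L

edgeChoice-first : ∀ L k → suc k + suc k ≤ L + 3 → EdgeChoice L (suc k) (k * suc L + 1)
edgeChoice-first L k 2k≤L+3 =
  edgeChoice (suc k) L ≤-refl (≤-trans 2k≤L+3 (m≤n+m (L + 3) L)) (inj₁ ≤-refl) (balance L k)
  where
  balance : ∀ L k → k * suc L + 1 + L ≡ suc k * suc L
  balance = solve-∀

-- Raising D by one lowers s by one, unless s is 0 or 2e ≤ s + L + 3 would fail; then e grows.
edgeChoice-suc : ∀ r {k D} → EdgeChoice (2 + r) k D → EdgeChoice (2 + r) k (suc D)
edgeChoice-suc r {D = D} (edgeChoice e zero k≤e fits _ balance) =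
  edgeChoice (suc e) (2 + r) (≤-trans k≤e (n≤1+n e)) fits′ (inj₁ ≤-refl) balance′
  where
  fits′ : suc e + suc e ≤ 2 + r + (2 + r + 3)
  fits′ = ≤-trans (≤-reflexive (cong suc (+-suc e e)))
            (≤-trans (+-monoʳ-≤ 2 fits) (+-monoˡ-≤ (2 + r + 3) (m≤m+n 2 r)))
  balance′ : suc D + (2 + r) ≡ suc e * (3 + r)
  balance′ = trans (regroup D r) (trans (cong (_+ (3 + r)) balance) (+-comm (e * (3 + r)) (3 + r)))
    where
    regroup : ∀ D r → suc D + (2 + r) ≡ D + 0 + (3 + r)
    regroup = solve-∀
edgeChoice-suc r {D = D} (edgeChoice e (suc s) k≤e fits small balance) with e + e ≤? s + (2 + r + 3)
... | yes fits′ = edgeChoice e s k≤e fits′ (Sum.map (≤-trans (n≤1+n s)) (≤-trans (n≤1+n (s + 3))) small)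
                             (trans (sym (+-suc D s)) balance)
... | no ¬fits′ = edgeChoice (suc e) (suc s + (2 + r)) (≤-trans k≤e (n≤1+n e)) fits′ (inj₂ small′) balance′
  where
  tight : e + e ≡ suc s + (2 + r + 3)
  tight = ≤-antisym fits (≰⇒> ¬fits′)
  double : suc e + suc e ≡ 2 + (e + e)
  double = cong suc (+-suc e e)
  fits′ : suc e + suc e ≤ suc s + (2 + r) + (2 + r + 3)
  fits′ = ≤-by r (trans (cong (_+ r) (trans double (cong (2 +_) tight))) (regroup s r))
    where
    regroup : ∀ s r → 2 + (suc s + (2 + r + 3)) + r ≡ suc s + (2 + r) + (2 + r + 3)
    regroup = solve-∀
  small′ : suc s + (2 + r) + 3 ≤ suc e + suc e
  small′ = ≤-by 2 (trans (regroup s r) (sym (trans double (cong (2 +_) tight))))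
    where
    regroup : ∀ s r → suc s + (2 + r) + 3 + 2 ≡ 2 + (suc s + (2 + r + 3))
    regroup = solve-∀
  balance′ : suc D + (suc s + (2 + r)) ≡ suc e * (3 + r)
  balance′ = trans (regroup D s r) (trans (cong (_+ (3 + r)) balance) (+-comm (e * (3 + r)) (3 + r)))
    where
    regroup : ∀ D s r → suc D + (suc s + (2 + r)) ≡ D + suc s + (3 + r)
    regroup = solve-∀

edgeChoice-from : ∀ r k d → suc k + suc k ≤ 2 + r + 3 → EdgeChoice (2 + r) (suc k) (k * (3 + r) + 1 + d)
edgeChoice-from r k zero    h =
  subst (EdgeChoice (2 + r) (suc k)) (sym (+-identityʳ _)) (edgeChoice-first (2 + r) k h)
edgeChoice-from r k (suc d) h =
  subst (EdgeChoice (2 + r) (suc k)) (sym (+-suc _ d)) (edgeChoice-suc r (edgeChoice-from r k d h))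

-- In both bounds, eliminating D and s from the hypotheses equates zero with a positive number.
tooManyEdges : ∀ {L D e s} → 1 ≤ L → 3 + L ≤ e → s + 3 ≤ e + e → D + s ≡ e * suc L →
  D + D + 2 ≰ L * (2 * L + 3)
tooManyEdges {suc L′} {D} {e} {s} _ 3+L≤e s+3≤2e D+s upper
  with m≤n⇒∃[o]m+o≡n 3+L≤e | m≤n⇒∃[o]m+o≡n s+3≤2e | m≤n⇒∃[o]m+o≡n upper
... | x , refl | z , s+3+z | u , D+D+2+u =
  m+1+n≢m rhs (trans (sym (identity L′ x z u D s)) combined)
  where
  e′ = 3 + suc L′ + x
  rhs = suc L′ * (2 * suc L′ + 3) + (e′ + e′) * 2 + (D + s) * 2
  combined : (D + D + 2 + u) + (s + 3 + z) * 2 + (e′ * suc (suc L′)) * 2 ≡ rhs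
  combined = cong₂ _+_ (cong₂ _+_ D+D+2+u (cong (_* 2) s+3+z)) (cong (_* 2) (sym D+s))
  identity : ∀ L′ x z u D s →
    (D + D + 2 + u) + (s + 3 + z) * 2 + ((3 + suc L′ + x) * suc (suc L′)) * 2
      ≡ suc L′ * (2 * suc L′ + 3) + ((3 + suc L′ + x) + (3 + suc L′ + x)) * 2 + (D + s) * 2
        + suc (1 + u + 2 * z + suc L′ + 2 * x * L′)
  identity = solve-∀

fewPathsAtTop : ∀ {L D s} → s ≤ 1 + L → D + s ≡ (2 + L) * suc L → D + D + 2 ≰ L * (2 * L + 3)
fewPathsAtTop {L} {D} {s} s≤1+L D+s upper with m≤n⇒∃[o]m+o≡n s≤1+L | m≤n⇒∃[o]m+o≡n upper
... | y , s+y | u , D+D+2+u = m+1+n≢m rhs (trans (sym (identity L y u D s)) combined)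
  where
  rhs = L * (2 * L + 3) + (1 + L) * 2 + (D + s) * 2
  combined : (D + D + 2 + u) + (s + y) * 2 + ((2 + L) * suc L) * 2 ≡ rhs
  combined = cong₂ _+_ (cong₂ _+_ D+D+2+u (cong (_* 2) s+y)) (cong (_* 2) (sym D+s))
  identity : ∀ L y u D s →
    (D + D + 2 + u) + (s + y) * 2 + ((2 + L) * suc L) * 2
      ≡ L * (2 * L + 3) + (1 + L) * 2 + (D + s) * 2 + suc (u + 2 * y + L + 3)
  identity = solve-∀

module _ {L k D : ℕ} (choice : EdgeChoice L k D) where
  open EdgeChoice choice

  edgeChoice-≤ : 1 ≤ L → D + D + 2 ≤ L * (2 * L + 3) → e ≤ 2 + L
  edgeChoice-≤ 1≤L upper with e ≤? 2 + L
  ... | yes e≤2+L = e≤2+L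
  ... | no  e≰2+L = ⊥-elim (tooManyEdges 1≤L 3+L≤e s+3≤2e balance upper)
    where
    3+L≤e = ≰⇒> e≰2+L
    L+3≤2e : L + 3 ≤ e + e
    L+3≤2e = ≤-trans (≤-reflexive (+-comm L 3)) (≤-trans 3+L≤e (m≤m+n e e))
    s+3≤2e : s + 3 ≤ e + e
    s+3≤2e = Sum.[ (λ s≤L → ≤-trans (+-monoˡ-≤ 3 s≤L) L+3≤2e) , id ] small

  edgeChoice-top : D + D + 2 ≤ L * (2 * L + 3) → e ≡ 2 + L → 2 + L ≤ s × s + 3 ≤ e + e
  edgeChoice-top upper refl with s ≤? 1 + L
  ... | yes s≤1+L = ⊥-elim (fewPathsAtTop s≤1+L balance upper)
  ... | no  s≰1+L = ≰⇒> s≰1+L , Sum.[ (λ s≤L → ⊥-elim (s≰1+L (≤-trans s≤L (n≤1+n L)))) , id ] small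

  edgeChoice-paths : L + 2 ≤ k + k → s + 2 ≤ e + e
  edgeChoice-paths L+2≤2k = Sum.[ (λ s≤L → ≤-trans (+-monoˡ-≤ 2 s≤L) (≤-trans L+2≤2k (+-mono-≤ k≤e k≤e)))
                                , (λ s+3≤2e → ≤-trans (+-monoʳ-≤ s (n≤1+n 2)) s+3≤2e) ] small

  edgeChoice-realizable : ∀ {m} → 13 ≤ L → 8 ≤ k → L + 2 ≤ k + k → D + D + 2 ≤ L * (2 * L + 3) →
    m + D ≡ C₃ (4 + L) → Realizable (4 + L) m
  edgeChoice-realizable 13≤L 8≤k L+2≤2k upper m+D with s + 2 ≤? e
  ... | yes s+2≤e = pathMatching-realizable s+2≤e fits m+D balance
  ... | no  s+2≰e =
    caterpillar-realizable′ 13≤L (≤-trans 8≤k k≤e) (≤-pred (subst (suc e ≤_) (+-suc s 1) (≰⇒> s+2≰e)))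
      (edgeChoice-paths L+2≤2k) (edgeChoice-≤ (≤-trans (s≤s z≤n) 13≤L) upper) (edgeChoice-top upper)
      m+D balance

half-≤ : ∀ {a k} → a + a < k + k → a < k
half-≤ {a} {k} a+a<k+k with a <? k
... | yes a<k = a<k
... | no  a≮k = ⊥-elim (<-irrefl refl (≤-trans a+a<k+k (+-mono-≤ k≤a k≤a)))
  where k≤a = ≮⇒≥ a≮k

-- Write D = (k − 1)(L + 1) + d. For d = 0 a path and a matching suffice; otherwise raise D
-- one at a time from (k − 1)(L + 1) + 1.
topRange-realizable : ∀ {L k D m} → 13 ≤ L → L + 2 ≤ k + k → k + k ≤ L + 3 →
  k * suc L ≤ D + suc L → D + D + 2 ≤ L * (2 * L + 3) → m + D ≡ C₃ (4 + L) → Realizable (4 + L) m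
topRange-realizable {L} {k} {D} 13≤L L+2≤2k 2k≤L+3 lower upper m+D
  with m≤n⇒∃[o]m+o≡n (≤-trans (≤-by {2} {13} 11 refl) 13≤L)
     | half-≤ {7} {k} (≤-trans (+-monoˡ-≤ 2 13≤L) L+2≤2k)
... | r , refl | 8≤k with k | 8≤k | L+2≤2k | lower | 2k≤L+3
... | suc k₁ | s≤s 7≤k₁ | L+2≤2k′ | lower′ | 2k≤L+3′
  with m≤n⇒∃[o]m+o≡n (+-cancelʳ-≤ (3 + r) (k₁ * (3 + r)) D
                        (subst (_≤ D + (3 + r)) (+-comm (3 + r) (k₁ * (3 + r))) lower′))
... | zero , refl =
  pathMatching-realizable (≤-trans (≤-by {2} {7} 5 refl) 7≤k₁)
    (≤-trans (+-mono-≤ (n≤1+n k₁) (n≤1+n k₁)) 2k≤L+3′) m+D (trans (+-identityʳ _) (+-identityʳ _))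
... | suc d , refl =
  edgeChoice-realizable
    (subst (EdgeChoice (2 + r) (suc k₁)) (+-assoc (k₁ * (3 + r)) 1 d) (edgeChoice-from r k₁ d 2k≤L+3′))
    13≤L (s≤s 7≤k₁) L+2≤2k′ upper m+D

-- Large n

nC2≡C₂ : ∀ n → n C 2 ≡ C₂ n
nC2≡C₂ zero    = refl
nC2≡C₂ (suc n) =
  trans (sym (nCk+nC[k+1]≡[n+1]C[k+1] n 1)) (trans (cong₂ _+_ (nC1≡n n) (nC2≡C₂ n)) (+-comm n (C₂ n)))

nC3≡C₃ : ∀ n → n C 3 ≡ C₃ n
nC3≡C₃ zero    = refl
nC3≡C₃ (suc n) =
  trans (sym (nCk+nC[k+1]≡[n+1]C[k+1] n 2)) (trans (cong₂ _+_ (nC2≡C₂ n) (nC3≡C₃ n)) (+-comm (C₂ n) (C₃ n)))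

U : ℕ → ℕ
U n = (n C 3) ∸ (n ∸ 3) * ⌈ (n ∸ 2) /2⌉ + f (n ∸ 2)

TopRange : ℕ → Set
TopRange n = ∀ {m} → U n + n < m → m ≤ U (suc n) → Realizable (suc n) m

n≤⌈n/2⌉+⌈n/2⌉ : ∀ n → n ≤ ⌈ n /2⌉ + ⌈ n /2⌉
n≤⌈n/2⌉+⌈n/2⌉ n = subst (_≤ ⌈ n /2⌉ + ⌈ n /2⌉) (⌊n/2⌋+⌈n/2⌉≡n n) (+-monoˡ-≤ ⌈ n /2⌉ (⌊n/2⌋≤⌈n/2⌉ n))

⌈n/2⌉+⌈n/2⌉≤1+n : ∀ n → ⌈ n /2⌉ + ⌈ n /2⌉ ≤ suc n
⌈n/2⌉+⌈n/2⌉≤1+n n =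
  ≤-trans (+-monoˡ-≤ ⌈ n /2⌉ (⌊n/2⌋-mono (n≤1+n (suc n)))) (≤-reflexive (cong suc (⌊n/2⌋+⌈n/2⌉≡n n)))

*≤C₂ : ∀ a k b → k + k ≤ suc b → a ≤ b → a * k ≤ C₂ (suc b)
*≤C₂ a k b 2k≤1+b a≤b = *-cancelˡ-≤ 2 (begin
  2 * (a * k)    ≡⟨ regroup a k ⟩
  a * (k + k)    ≤⟨ *-monoʳ-≤ a 2k≤1+b ⟩
  a * suc b      ≤⟨ *-monoˡ-≤ (suc b) a≤b ⟩
  b * suc b      ≡⟨ *-comm b (suc b) ⟩
  suc b * b      ≡⟨ C₂-double b ⟨
  C₂ (suc b) + C₂ (suc b) ≡⟨ regroup′ (C₂ (suc b)) ⟩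
  2 * C₂ (suc b) ∎)
  where
  open ≤-Reasoning
  regroup : ∀ a k → 2 * (a * k) ≡ a * (k + k)
  regroup = solve-∀
  regroup′ : ∀ c → c + c ≡ 2 * c
  regroup′ = solve-∀

C₂≤C₃ : ∀ n → C₂ n ≤ C₃ (suc n)
C₂≤C₃ n = m≤n+m (C₂ n) (C₃ n)

-- With truncated subtraction removed, the two ends of the range bound D = C(n,3) − m.
deficit-lower : ∀ {A q k m} → q * k ≤ A → 1 ≤ k → m ≤ A ∸ q * k + q → m ≤ A × k * q ≤ (A ∸ m) + q
deficit-lower {A} {q} {k} {m} qk≤A 1≤k m≤ = m≤A , k*q≤D+q
  where
  m+qk≤A+q : m + q * k ≤ A + q
  m+qk≤A+q = ≤-trans (+-monoˡ-≤ (q * k) m≤) (≤-reflexive (begin-equality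
    A ∸ q * k + q + q * k   ≡⟨ +-assoc (A ∸ q * k) q (q * k) ⟩
    A ∸ q * k + (q + q * k) ≡⟨ cong (A ∸ q * k +_) (+-comm q (q * k)) ⟩
    A ∸ q * k + (q * k + q) ≡⟨ +-assoc (A ∸ q * k) (q * k) q ⟨
    A ∸ q * k + q * k + q   ≡⟨ cong (_+ q) (m∸n+n≡m qk≤A) ⟩
    A + q                   ∎))
    where open ≤-Reasoning
  m≤A : m ≤ A
  m≤A = +-cancelʳ-≤ q m A (≤-trans (+-monoʳ-≤ m q≤qk) m+qk≤A+q)
    where q≤qk = ≤-trans (≤-reflexive (sym (*-identityʳ q))) (*-monoʳ-≤ q 1≤k)
  k*q≤D+q : k * q ≤ (A ∸ m) + q
  k*q≤D+q = +-cancelˡ-≤ m (k * q) (A ∸ m + q)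
    (subst₂ _≤_ (cong (m +_) (*-comm q k))
                (trans (cong (_+ q) (sym (m+[n∸m]≡n m≤A))) (+-assoc m (A ∸ m) q)) m+qk≤A+q)

deficit-upper : ∀ {A′ c L kp m} → L * kp ≤ A′ → A′ ∸ L * kp + L + (3 + L) < m → m ≤ A′ + c →
  (A′ + c ∸ m) + L + (4 + L) ≤ c + L * kp
deficit-upper {A′} {c} {L} {kp} {m} Lkp≤A′ lo m≤A = +-cancelˡ-≤ m _ _ (begin
  m + ((A′ + c ∸ m) + L + (4 + L))     ≡⟨ regroup m (A′ + c ∸ m) L ⟩
  (m + (A′ + c ∸ m)) + (L + (4 + L))   ≡⟨ cong (_+ (L + (4 + L))) (m+[n∸m]≡n m≤A) ⟩
  A′ + c + (L + (4 + L))               ≡⟨ regroup′ A′ c L ⟩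
  c + suc (A′ + (L + (3 + L)))         ≤⟨ +-monoʳ-≤ c lo′ ⟩
  c + (m + L * kp)                     ≡⟨ x∙yz≈y∙xz c m (L * kp) ⟩
  m + (c + L * kp)                     ∎)
  where
  open ≤-Reasoning
  regroup : ∀ m D L → m + (D + L + (4 + L)) ≡ (m + D) + (L + (4 + L))
  regroup = solve-∀
  regroup′ : ∀ A c L → A + c + (L + (4 + L)) ≡ c + suc (A + (L + (3 + L)))
  regroup′ = solve-∀
  lo′ : A′ + (L + (3 + L)) < m + L * kp
  lo′ = subst (_< m + L * kp) shift (+-monoˡ-≤ (L * kp) lo)
    where
    regroup″ : ∀ a L b → a + L + (3 + L) + b ≡ a + b + (L + (3 + L))
    regroup″ = solve-∀
    shift : A′ ∸ L * kp + L + (3 + L) + L * kp ≡ A′ + (L + (3 + L))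
    shift = trans (regroup″ (A′ ∸ L * kp) L (L * kp)) (cong (_+ (L + (3 + L))) (m∸n+n≡m Lkp≤A′))

deficit-upper-2 : ∀ {D c L kp} → D + L + (4 + L) ≤ c + L * kp → c + c ≡ (3 + L) * (2 + L) →
  kp + kp ≤ 2 + L → D + D + 2 ≤ L * (2 * L + 3)
deficit-upper-2 {D} {c} {L} {kp} D≤ cc kp≤ = +-cancelʳ-≤ (4 * L + 6) _ _ (begin
  D + D + 2 + (4 * L + 6)               ≡⟨ regroup D L ⟩
  (D + L + (4 + L)) + (D + L + (4 + L)) ≤⟨ +-mono-≤ D≤ D≤ ⟩
  (c + L * kp) + (c + L * kp)           ≡⟨ interchange c (L * kp) c (L * kp) ⟩
  (c + c) + (L * kp + L * kp)           ≡⟨ cong₂ _+_ cc (sym (*-distribˡ-+ L kp kp)) ⟩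
  (3 + L) * (2 + L) + L * (kp + kp)     ≤⟨ +-monoʳ-≤ ((3 + L) * (2 + L)) (*-monoʳ-≤ L kp≤) ⟩
  (3 + L) * (2 + L) + L * (2 + L)       ≡⟨ regroup′ L ⟩
  L * (2 * L + 3) + (4 * L + 6)         ∎)
  where
  open ≤-Reasoning
  regroup : ∀ D L → D + D + 2 + (4 * L + 6) ≡ (D + L + (4 + L)) + (D + L + (4 + L))
  regroup = solve-∀
  regroup′ : ∀ L → (3 + L) * (2 + L) + L * (2 + L) ≡ L * (2 * L + 3) + (4 * L + 6)
  regroup′ = solve-∀

topRange-large : ∀ x → TopRange (16 + x)
topRange-large x {m} lo hi =
  topRange-realizable {L} {k} {A ∸ m} (m≤m+n 13 x) L+2≤2k 2k≤L+3 lower upper (m+[n∸m]≡n m≤A)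
  where
  L  = 13 + x
  k  = ⌈ 15 + x /2⌉
  kp = ⌈ 14 + x /2⌉
  A  = C₃ (17 + x)
  A′ = C₃ (16 + x)
  Lkp≤A′ : L * kp ≤ A′
  Lkp≤A′ = ≤-trans (*≤C₂ L kp (14 + x) (⌈n/2⌉+⌈n/2⌉≤1+n (14 + x)) (n≤1+n L)) (C₂≤C₃ (15 + x))
  qk≤A : (14 + x) * k ≤ A
  qk≤A = ≤-trans (*≤C₂ (14 + x) k (15 + x) (⌈n/2⌉+⌈n/2⌉≤1+n (15 + x)) (n≤1+n (14 + x))) (C₂≤C₃ (16 + x))
  lo′ : A′ ∸ L * kp + L + (3 + L) < m
  lo′ = subst (λ z → z ∸ L * kp + L + (3 + L) < m) (nC3≡C₃ (16 + x)) lo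
  hi′ : m ≤ A ∸ (14 + x) * k + (14 + x)
  hi′ = subst (λ z → m ≤ z ∸ (14 + x) * k + (14 + x)) (nC3≡C₃ (17 + x)) hi
  m≤A : m ≤ A
  m≤A = proj₁ (deficit-lower {A} {14 + x} {k} qk≤A (s≤s z≤n) hi′)
  lower : k * (14 + x) ≤ (A ∸ m) + (14 + x)
  lower = proj₂ (deficit-lower {A} {14 + x} {k} qk≤A (s≤s z≤n) hi′)
  upper : (A ∸ m) + (A ∸ m) + 2 ≤ L * (2 * L + 3)
  upper = deficit-upper-2 {A ∸ m} {C₂ (16 + x)} {L} {kp}
    (deficit-upper {A′} {C₂ (16 + x)} {L} {kp} Lkp≤A′ lo′ m≤A) (C₂-double (15 + x)) (⌈n/2⌉+⌈n/2⌉≤1+n (14 + x))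
  L+2≤2k : L + 2 ≤ k + k
  L+2≤2k = subst (_≤ k + k) (+-comm 2 L) (n≤⌈n/2⌉+⌈n/2⌉ (15 + x))
  2k≤L+3 : k + k ≤ L + 3
  2k≤L+3 = subst (k + k ≤_) (+-comm 3 L) (⌈n/2⌉+⌈n/2⌉≤1+n (15 + x))

-- Small n

record ForestParams : Set where
  constructor par
  field
    p X a w : ℕ

Fits : ℕ → ℕ → ForestParams → Set
Fits N m (par p X a w) = Undominated p X a w × N ≡ p + legCost X + a * 2 + w + 3 ×
  m + forestEdges p X a * N ≡ C₃ N + 3 * forestEdges p X a + forestPaths p X

fits? : ∀ N m P → Dec (Fits N m P)
fits? N m (par p X a w) =
  (1 ≤? w ⊎-dec 1 ≤? a ⊎-dec (1 ≤? p ×-dec 1 ≤? X)) ×-dec (N ≟ _) ×-dec (m + forestEdges p X a * N ≟ _)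

Fits⇒realizable : ∀ {N m} P → Fits N m P → Realizable N m
Fits⇒realizable (par p X a w) (undominated , N≡ , m≡) = forest-realizable p X a w undominated N≡ m≡

Covers : ℕ → ℕ → List ForestParams → Set
Covers N lo []       = Unit
Covers N lo (P ∷ Ps) = Fits N lo P × Covers N (suc lo) Ps

covers? : ∀ N lo Ps → Dec (Covers N lo Ps)
covers? N lo []       = yes tt
covers? N lo (P ∷ Ps) = fits? N lo P ×-dec covers? N (suc lo) Ps

Covers⇒realizable : ∀ {N lo} Ps → Covers N lo Ps → ∀ {m} → lo ≤ m → m < lo + length Ps → Realizable N m
Covers⇒realizable {lo = lo} [] _ {m} lo≤m m<lo+0 = ⊥-elim (≤⇒≯ lo≤m (subst (m <_) (+-identityʳ lo) m<lo+0))
Covers⇒realizable {lo = lo} (P ∷ Ps) (fits , covers) {m} lo≤m m< with lo ≟ m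
... | yes refl = Fits⇒realizable P fits
... | no  lo≢m = Covers⇒realizable Ps covers (≤∧≢⇒< lo≤m lo≢m) (subst (m <_) (+-suc lo (length Ps)) m<)

-- topTable (n + 1) lists forest parameters for the sizes U n + n + 1, …, U (n + 1).
topTable : ℕ → List ForestParams
topTable 7 =
  par 0 1 1 0 ∷ par 0 0 2 0 ∷ par 1 0 1 1 ∷ par 0 3 0 1 ∷ par 0 1 0 2 ∷ []
topTable 8 =
  par 2 3 0 0 ∷ par 1 1 1 0 ∷ par 2 1 0 1 ∷ par 0 2 0 1 ∷ par 1 3 0 1 ∷ par 0 1 1 1 ∷ par 1 1 0 2 ∷
  par 0 0 2 1 ∷ par 0 3 0 2 ∷ par 2 0 0 3 ∷ par 0 1 0 3 ∷ []
topTable 9 =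
  par 2 1 1 0 ∷ par 0 2 1 0 ∷ par 1 2 0 1 ∷ par 2 0 2 0 ∷ par 0 1 2 0 ∷ par 0 6 1 0 ∷ par 1 6 0 1 ∷
  par 0 0 3 0 ∷ par 1 0 2 1 ∷ par 2 0 1 2 ∷ par 0 1 1 2 ∷ par 0 6 0 2 ∷ []
topTable 10 =
  par 4 3 0 0 ∷ par 2 4 0 0 ∷ par 5 0 1 0 ∷ par 3 1 1 0 ∷ par 1 2 1 0 ∷ par 2 2 0 1 ∷ par 0 4 1 0 ∷
  par 1 4 0 1 ∷ par 1 1 2 0 ∷ par 2 1 1 1 ∷ par 0 2 1 1 ∷ par 1 2 0 2 ∷ par 1 0 3 0 ∷ par 0 4 0 2 ∷
  par 0 1 2 1 ∷ par 1 1 1 2 ∷ par 2 1 0 3 ∷ par 0 2 0 3 ∷ par 0 0 3 1 ∷ par 1 0 2 2 ∷ par 2 0 1 3 ∷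
  par 0 1 1 3 ∷ par 1 1 0 4 ∷ []
topTable 11 =
  par 4 6 0 0 ∷ par 2 7 0 0 ∷ par 2 2 1 0 ∷ par 1 9 0 0 ∷ par 1 4 1 0 ∷ par 2 4 0 1 ∷ par 0 5 0 1 ∷
  par 0 7 1 0 ∷ par 0 2 2 0 ∷ par 1 2 1 1 ∷ par 0 9 0 1 ∷ par 0 4 1 1 ∷ par 0 6 2 0 ∷ par 0 1 3 0 ∷
  par 1 1 2 1 ∷ par 0 7 0 2 ∷ par 0 2 1 2 ∷ par 1 2 0 3 ∷ par 0 0 4 0 ∷ par 0 4 0 3 ∷ par 0 6 1 2 ∷
  par 0 1 2 2 ∷ par 1 1 1 3 ∷ par 2 1 0 4 ∷ par 0 2 0 4 ∷ par 1 3 0 4 ∷ []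
topTable 12 =
  par 2 5 0 0 ∷ par 5 6 0 0 ∷ par 3 7 0 0 ∷ par 1 8 0 0 ∷ par 2 9 0 0 ∷ par 4 2 0 1 ∷ par 2 4 1 0 ∷
  par 0 5 1 0 ∷ par 1 5 0 1 ∷ par 1 7 1 0 ∷ par 2 7 0 1 ∷ par 0 8 0 1 ∷ par 1 9 0 1 ∷ par 0 4 2 0 ∷
  par 1 4 1 1 ∷ par 0 12 0 1 ∷ par 0 5 0 2 ∷ par 0 7 1 1 ∷ par 1 7 0 2 ∷ par 0 2 2 1 ∷ par 0 9 0 2 ∷
  par 2 2 0 3 ∷ par 0 4 1 2 ∷ par 0 6 2 1 ∷ par 1 6 1 2 ∷ par 0 1 3 1 ∷ par 0 7 0 3 ∷ par 2 1 1 3 ∷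
  par 0 2 1 3 ∷ par 1 2 0 4 ∷ par 2 3 0 4 ∷ par 0 0 4 1 ∷ par 0 6 1 3 ∷ par 1 6 0 4 ∷ par 0 1 2 3 ∷
  par 1 1 1 4 ∷ par 2 1 0 5 ∷ par 0 2 0 5 ∷ par 1 3 0 5 ∷ []
topTable 13 =
  par 3 9 0 0 ∷ par 1 10 0 0 ∷ par 5 2 0 1 ∷ par 2 12 0 0 ∷ par 1 5 1 0 ∷ par 2 5 0 1 ∷ par 2 7 1 0 ∷
  par 0 8 1 0 ∷ par 1 8 0 1 ∷ par 2 2 2 0 ∷ par 0 10 0 1 ∷ par 0 12 1 0 ∷ par 1 12 0 1 ∷ par 0 5 1 1 ∷
  par 0 7 2 0 ∷ par 1 7 1 1 ∷ par 2 1 3 0 ∷ par 0 2 3 0 ∷ par 1 2 2 1 ∷ par 2 2 1 2 ∷ par 0 4 2 1 ∷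
  par 0 6 3 0 ∷ par 1 6 2 1 ∷ par 0 5 0 3 ∷ par 0 1 4 0 ∷ par 1 1 3 1 ∷ par 2 1 2 2 ∷ par 0 2 2 2 ∷
  par 1 2 1 3 ∷ par 2 2 0 4 ∷ par 0 4 1 3 ∷ par 0 0 5 0 ∷ par 1 0 4 1 ∷ par 2 0 3 2 ∷ par 0 1 3 2 ∷
  par 1 1 2 3 ∷ par 2 1 1 4 ∷ par 0 2 1 4 ∷ par 1 2 0 5 ∷ par 2 3 0 5 ∷ par 0 4 0 5 ∷ par 0 0 4 2 ∷ []
topTable 14 =
  par 5 7 0 0 ∷ par 3 8 0 0 ∷ par 4 9 0 0 ∷ par 2 10 0 0 ∷ par 5 2 1 0 ∷ par 3 12 0 0 ∷ par 1 13 0 0 ∷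
  par 2 5 1 0 ∷ par 3 5 0 1 ∷ par 3 7 1 0 ∷ par 1 8 1 0 ∷ par 2 8 0 1 ∷ par 0 10 1 0 ∷ par 1 10 0 1 ∷
  par 1 12 1 0 ∷ par 2 4 2 0 ∷ par 0 5 2 0 ∷ par 1 5 1 1 ∷ par 1 7 2 0 ∷ par 2 7 1 1 ∷ par 0 8 1 1 ∷
  par 1 8 0 2 ∷ par 1 2 3 0 ∷ par 0 10 0 2 ∷ par 0 4 3 0 ∷ par 1 4 2 1 ∷ par 1 6 3 0 ∷ par 0 5 1 2 ∷
  par 0 7 2 1 ∷ par 1 7 1 2 ∷ par 1 1 4 0 ∷ par 0 8 0 3 ∷ par 0 2 3 1 ∷ par 1 2 2 2 ∷ par 2 2 1 3 ∷
  par 0 4 2 2 ∷ par 0 6 3 1 ∷ par 1 6 2 2 ∷ par 0 5 0 4 ∷ par 0 7 1 3 ∷ par 0 1 4 1 ∷ par 1 1 3 2 ∷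
  par 0 9 0 4 ∷ par 0 2 2 3 ∷ par 1 2 1 4 ∷ par 2 2 0 5 ∷ par 0 4 1 4 ∷ par 0 6 2 3 ∷ par 0 0 5 1 ∷
  par 1 0 4 2 ∷ par 0 7 0 5 ∷ par 0 1 3 3 ∷ par 1 1 2 4 ∷ par 2 1 1 5 ∷ par 0 2 1 5 ∷ par 1 2 0 6 ∷
  par 2 3 0 6 ∷ par 0 4 0 6 ∷ par 0 6 1 5 ∷ par 0 0 4 3 ∷ []
topTable 15 =
  par 2 13 0 0 ∷ par 5 4 1 0 ∷ par 1 15 0 0 ∷ par 4 5 0 1 ∷ par 4 7 1 0 ∷ par 2 8 1 0 ∷ par 3 8 0 1 ∷
  par 1 10 1 0 ∷ par 2 10 0 1 ∷ par 0 11 0 1 ∷ par 0 13 1 0 ∷ par 1 13 0 1 ∷ par 1 5 2 0 ∷ par 0 15 0 1 ∷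
  par 2 7 2 0 ∷ par 0 8 2 0 ∷ par 1 8 1 1 ∷ par 2 8 0 2 ∷ par 0 10 1 1 ∷ par 0 12 2 0 ∷ par 1 12 1 1 ∷
  par 1 4 3 0 ∷ par 0 13 0 2 ∷ par 0 5 2 1 ∷ par 0 7 3 0 ∷ par 1 7 2 1 ∷ par 2 7 1 2 ∷ par 0 8 1 2 ∷
  par 1 8 0 3 ∷ par 0 2 4 0 ∷ par 0 10 0 3 ∷ par 0 12 1 2 ∷ par 0 4 3 1 ∷ par 0 6 4 0 ∷ par 1 6 3 1 ∷
  par 0 5 1 3 ∷ par 0 7 2 2 ∷ par 1 7 1 3 ∷ par 0 1 5 0 ∷ par 0 8 0 4 ∷ par 1 9 0 4 ∷ par 0 2 3 2 ∷
  par 1 2 2 3 ∷ par 0 12 0 4 ∷ par 0 4 2 3 ∷ par 0 6 3 2 ∷ par 1 6 2 3 ∷ par 0 0 6 0 ∷ par 0 7 1 4 ∷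
  par 1 7 0 5 ∷ par 0 1 4 2 ∷ par 0 9 0 5 ∷ par 2 1 2 4 ∷ par 0 2 2 4 ∷ par 1 2 1 5 ∷ par 2 2 0 6 ∷
  par 0 4 1 5 ∷ par 0 6 2 4 ∷ par 1 6 1 5 ∷ par 0 0 5 2 ∷ []
topTable 16 =
  par 5 8 0 0 ∷ par 6 9 0 0 ∷ par 4 10 0 0 ∷ par 2 11 0 0 ∷ par 5 12 0 0 ∷ par 3 13 0 0 ∷ par 1 14 0 0 ∷
  par 2 15 0 0 ∷ par 4 5 1 0 ∷ par 5 5 0 1 ∷ par 1 18 0 0 ∷ par 3 8 1 0 ∷ par 4 8 0 1 ∷ par 2 10 1 0 ∷
  par 0 11 1 0 ∷ par 1 11 0 1 ∷ par 1 13 1 0 ∷ par 2 13 0 1 ∷ par 0 14 0 1 ∷ par 1 15 0 1 ∷ par 3 5 1 1 ∷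
  par 3 7 2 0 ∷ par 0 18 0 1 ∷ par 2 8 1 1 ∷ par 0 10 2 0 ∷ par 1 10 1 1 ∷ par 1 12 2 0 ∷ par 0 11 0 2 ∷
  par 0 13 1 1 ∷ par 1 13 0 2 ∷ par 0 5 3 0 ∷ par 0 15 0 2 ∷ par 1 7 3 0 ∷ par 2 7 2 1 ∷ par 0 8 2 1 ∷
  par 1 8 1 2 ∷ par 2 8 0 3 ∷ par 0 10 1 2 ∷ par 0 12 2 1 ∷ par 1 12 1 2 ∷ par 0 4 4 0 ∷ par 0 13 0 3 ∷
  par 1 6 4 0 ∷ par 0 5 2 2 ∷ par 0 7 3 1 ∷ par 1 7 2 2 ∷ par 2 7 1 3 ∷ par 0 8 1 3 ∷ par 1 1 5 0 ∷
  par 2 1 4 1 ∷ par 0 2 4 1 ∷ par 0 12 1 3 ∷ par 1 12 0 4 ∷ par 0 4 3 2 ∷ par 0 6 4 1 ∷ par 1 6 3 2 ∷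
  par 0 5 1 4 ∷ par 0 7 2 3 ∷ par 1 0 6 0 ∷ par 2 0 5 1 ∷ par 0 1 5 1 ∷ par 1 1 4 2 ∷ par 2 1 3 3 ∷
  par 0 2 3 3 ∷ par 0 12 0 5 ∷ par 2 2 1 5 ∷ par 0 4 2 4 ∷ par 0 6 3 3 ∷ par 1 6 2 4 ∷ par 0 5 0 6 ∷
  par 0 0 6 1 ∷ par 1 0 5 2 ∷ par 2 0 4 3 ∷ par 0 1 4 3 ∷ par 1 1 3 4 ∷ par 2 1 2 5 ∷ par 0 2 2 5 ∷
  par 1 2 1 6 ∷ par 2 2 0 7 ∷ par 0 4 1 6 ∷ par 0 6 2 5 ∷ par 1 6 1 6 ∷ par 2 6 0 7 ∷ par 0 0 5 3 ∷ []
topTable _ = []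

TopCovered : ℕ → Set
TopCovered n =
  Covers (suc n) (suc (U n + n)) (topTable (suc n)) × U (suc n) < suc (U n + n) + length (topTable (suc n))

topCovered? : ∀ n → Dec (TopCovered n)
topCovered? n = covers? (suc n) _ (topTable (suc n)) ×-dec (U (suc n) <? _)

topRange-small : ∀ i → i < 10 → TopRange (6 + i)
topRange-small i i<10 lo hi = Covers⇒realizable (topTable (7 + i)) covers lo (≤-trans (s≤s hi) fits)
  where
  covered : TopCovered (6 + i)
  covered = All.lookup (from-yes (All.all? (topCovered? ∘ (6 +_)) (upTo 10))) (∈-upTo⁺ i<10)
  covers = proj₁ covered
  fits = proj₂ covered

PairInTriple : Graph n → Subset n → Set
PairInTriple G S = ∣ S ∣ ≡ 2 → independent G S ≡ true → ∃ λ T → S ⊆ T × ∣ T ∣ ≡ 3 × independent G T ≡ true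

pairInTriple? : ∀ (G : Graph n) S → Dec (PairInTriple G S)
pairInTriple? G S = (∣ S ∣ ≟ 2) →-dec ((independent G S ≟ᵇ true) →-dec
  anySubset? (λ T → (S ⊆? T) ×-dec (∣ T ∣ ≟ 3) ×-dec (independent G T ≟ᵇ true)))

pairsInTriples-byCheck : ∀ (G : Graph n) → ¬ ∃ (λ S → ¬ PairInTriple G S) → PairsInTriples G
pairsInTriples-byCheck G noCounterexample S =
  decidable-stable (pairInTriple? G S) (λ ¬inTriple → noCounterexample (S , ¬inTriple))

K₄ : Graph 4
K₄ = ⊤ ◃ ⊤ ◃ ⊤ ◃ [] ◃ ∅

-- The 4-cycle 0-1-3-2 and the edge 4-5.
G₉ : Graph 6
G₉ = (true ∷ true ∷ false ∷ false ∷ false ∷ []) ◃ (false ∷ true ∷ false ∷ false ∷ []) ◃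
     (true ∷ false ∷ false ∷ []) ◃ (false ∷ false ∷ []) ◃ (true ∷ []) ◃ [] ◃ ∅

realizable-6 : ∀ {m} → 9 ≤ m → m ≤ 15 → Realizable 6 m
realizable-6 9≤m m≤15 with m≤n⇒∃[o]m+o≡n 9≤m
... | 0 , refl = G₉ , pairsInTriples-byCheck G₉ (from-no (anySubset? (¬? ∘ pairInTriple? G₉))) , refl
... | 1 , refl = ⊥ ◃ ⊥ ◃ K₄ , PairsInTriples-⊥◃ (⊥ ◃ K₄) (NoDominatingVertex-⊥◃ K₄ (s≤s z≤n)) , refl
... | 2 , refl = Realizable-⊤◃ (Fits⇒realizable {5} {6} (par 0 0 1 0) (from-yes (fits? 5 6 (par 0 0 1 0))))
... | suc (suc (suc j)) , refl =
  Covers⇒realizable tbl₆ (from-yes (covers? 6 12 tbl₆)) (+-monoʳ-≤ 12 z≤n) (s≤s m≤15)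
  where
  tbl₆ : List ForestParams
  tbl₆ = par 1 0 1 0 ∷ par 2 0 0 1 ∷ par 0 0 1 1 ∷ par 1 0 0 2 ∷ []

topRange : ∀ n → 6 ≤ n → TopRange n
topRange n 6≤n with n ≤? 15
... | yes n≤15 = small (m≤n⇒∃[o]m+o≡n 6≤n) n≤15
  where
  small : (∃ λ i → 6 + i ≡ n) → n ≤ 15 → TopRange n
  small (i , 6+i≡n) n≤15 =
    subst TopRange 6+i≡n (topRange-small i (+-cancelˡ-≤ 5 (suc i) 10 (subst (_≤ 15) (sym 6+i≡n) n≤15)))
... | no n≰15 = large (m≤n⇒∃[o]m+o≡n (≰⇒> n≰15))
  where
  large : (∃ λ x → 16 + x ≡ n) → TopRange n
  large (x , 16+x≡n) = subst TopRange 16+x≡n (topRange-large x)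

InRange : ℕ → Set
InRange n = ∀ m → (n C 2) ∸ 6 ≤ m → m ≤ U n → Realizable n m

inRange-6 : InRange 6
inRange-6 m 9≤m m≤15 = realizable-6 9≤m m≤15

inRange-suc : ∀ n → 6 ≤ n → InRange n → InRange (suc n)
inRange-suc n 6≤n inRange m lo hi with m ≤? U n + n
... | no  m≰ = topRange n 6≤n (≰⇒> m≰) hi
... | yes m≤ = subst (Realizable (suc n)) (m∸n+n≡m n≤m) (Realizable-⊤◃ (inRange (m ∸ n) lo′ hi′))
  where
  6≤nC2 : 6 ≤ n C 2
  6≤nC2 = subst (6 ≤_) (sym (nC2≡C₂ n)) (≤-trans (≤-by {6} {15} 9 refl) (C₂-mono 6≤n))
  lo″ : n C 2 ∸ 6 + n ≤ m
  lo″ = subst (_≤ m) (+-∸-comm n 6≤nC2) (subst (λ c → c ∸ 6 ≤ m) [n+1]C2≡nC2+n lo)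
    where [n+1]C2≡nC2+n = trans (nC2≡C₂ (suc n)) (cong (_+ n) (sym (nC2≡C₂ n)))
  n≤m : n ≤ m
  n≤m = ≤-trans (m≤n+m n _) lo″
  lo′ : n C 2 ∸ 6 ≤ m ∸ n
  lo′ = subst (_≤ m ∸ n) (m+n∸n≡m _ n) (∸-monoˡ-≤ n lo″)
  hi′ : m ∸ n ≤ U n
  hi′ = subst (m ∸ n ≤_) (m+n∸n≡m (U n) n) (∸-monoˡ-≤ n m≤)

inRange : ∀ n → 6 ≤ n → InRange n
inRange n 6≤n with m≤n⇒∃[o]m+o≡n 6≤n
... | i , refl = go i
  where
  go : ∀ i → InRange (6 + i)
  go zero    = inRange-6
  go (suc i) = inRange-suc (6 + i) (m≤m+n 6 i) (go i)

lemma3p3 : ∀ (n m : ℕ) → 6 ≤ n →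
    (n C 2) ∸ 6 ≤ m →
    m ≤ (n C 3) ∸ (n ∸ 3) * ⌈ (n ∸ 2) /2⌉ + f (n ∸ 2) →
    InS2 n m
lemma3p3 n m 6≤n lo hi with inRange n 6≤n m lo hi
... | G , pairs , refl = antichain-inS2 G (≤-trans (≤-by {2} {6} 4 refl) 6≤n) pairs
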